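{- Let $X,Y,Z$ be finite sets and let $T\subseteq X\times Y\times Z$ be a nonempty relation such that for every $(x,y)\in X\times Y$ there exists $z\in Z$ with $(x,y,z)\in T$. Then there is no gap between the integer program $\mathbf{PN}(T)$ and its linear programming relaxation: the optimal value of the linear program obtained from $\mathbf{PN}(T)$ by replacing $x\in\mathbb{N}^{\mathcal{M}(T)}$, $y\in\mathbb{N}^{\Gamma(T)}$ with nonnegative real vectors $x\in\mathbb{R}_{\ge 0}^{\mathcal{M}(T)}$, $y\in\mathbb{R}_{\ge 0}^{\Gamma(T)}$ equals the optimal value of $\mathbf{PN}(T)$, which equals the protocol partition number $C^P(T)$.
   Context: The communication matrix $M_T$ has rows indexed by $X$ and columns by $Y$; its cell set is $C_T=X\times Y$. A rectangle is a nonempty product $X'\times Y'\subseteq X\times Y$ (with $X',Y'$ nonempty); $\mathcal{R}(T)$ denotes the set of all rectangles and $\mathcal{R}^{\ast}(T)=\mathcal{R}(T)\setminus\{C_T\}$. A rectangle $X'\times Y'$ is monochromatic if there is $z\in Z$ with $(x,y,z)\in T$ for all $(x,y)\in X'\times Y'$; $\mathcal{M}(T)$ denotes the set of monochromatic rectangles. A partition of a rectangle $X'\times Y'$ is an unordered pair of rectangles $\{X'_1\times Y',X'_2\times Y'\}$ with $X'=X'_1\cup X'_2$, $X'_1\cap X'_2=\emptyset$, or $\{X'\times Y'_1,X'\times Y'_2\}$ with $Y'=Y'_1\cup Y'_2$, $Y'_1\cap Y'_2=\emptyset$; $\mathcal{P}(R)$ is the set of partitions of $R$, and for $P\in\mathcal{P}(R)$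 we write $V\in P$ if $V$ is one of the two rectangles of $P$. Let $\Gamma(T)=\{(R,P): R\in\mathcal{R}(T),\ P\in\mathcal{P}(R)\}$. A set $\mathcal{R}$ of pairwise disjoint rectangles recursively partitions $M_T$ if its union is $C_T$ and there is a rooted binary tree whose vertices correspond to rectangles, whose root corresponds to $C_T$, whose leaves correspond exactly to the rectangles of $\mathcal{R}$, and such that for each non-leaf vertex the rectangles of its two children form a partition of the rectangle of that vertex. The protocol partition number $C^P(T)$ is the minimum size of a set of pairwise disjoint monochromatic rectangles that recursively partitions $M_T$. The integer program $\mathbf{PN}(T)$ has variables $x\in\mathbb{N}^{\mathcal{M}(T)}$, $y\in\mathbb{N}^{\Gamma(T)}$ ($\mathbb{N}$ the nonnegative integers) and asks to minimize $\sum_{R\in\mathcal{M}(T)}x_R$ subject to (i) $\sum_{R\in\mathcal{M}(T):\,c\in R}x_R=1$ for every $c\in C_T$, and (ii) for every $R\in\mathcal{R}^{\ast}(T)$: $\sum_{V\in\mathcal{R}(T)}\sum_{P\in\mathcal{P}(V):\,R\in P}y_{V,P}=\sum_{P\in\mathcal{P}(R)}y_{R,P}+x_R$ if $R\in\mathcal{M}(T)$, and $=\sum_{P\in\mathcal{P}(R)}y_{R,P}$ otherwise.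
   Formalization: The variables x and y of the linear programming relaxation of $\mathbf{PN}(T)$ range over nonnegative rational vectors instead of nonnegative real vectors. -}

module Defs where

open import Data.Bool using (Bool; true; false; _∧_; _∨_; not; if_then_else_)
open import Data.Nat as ℕ using (ℕ; zero; suc)
open import Data.Integer using (+_)
open import Data.Fin using (Fin)
open import Data.Fin.Subset using (Subset; _∩_; ∁; ⊤)
open import Data.Vec using (Vec; []; _∷_; lookup)
open import Data.List using (List; []; _∷_; _++_; map; concatMap; filterᵇ; allFin; length; foldr)
open import Data.Bool.ListAction using (any; all)
open import Data.List.Membership.Propositional using (_∈_)
open import Data.List.Relation.Unary.All using (All)
open import Data.List.Relation.Unary.Any using (Any)
open import Data.List.Relation.Unary.AllPairs using (AllPairs)
open import Data.List.Relation.Binary.Permutation.Propositional using (_↭_)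
open import Data.Product using (Σ; ∃; _×_; _,_; proj₁; proj₂)
open import Relation.Binary.PropositionalEquality using (_≡_; _≢_)
open import Data.Rational as ℚ using (ℚ; 0ℚ; 1ℚ)

Rel3 : ℕ → ℕ → ℕ → Set
Rel3 nx ny nz = Fin nx → Fin ny → Fin nz → Bool

allSubsets : (n : ℕ) → List (Subset n)
allSubsets zero    = [] ∷ []
allSubsets (suc n) = map (true ∷_) (allSubsets n) ++ map (false ∷_) (allSubsets n)

nonemptyᵇ : ∀ {n} → Subset n → Bool
nonemptyᵇ []       = false
nonemptyᵇ (b ∷ bs) = b ∨ nonemptyᵇ bs

subᵇ : ∀ {n} → Subset n → Subset n → Bool
subᵇ []       []       = true
subᵇ (s ∷ ss) (x ∷ xs) = (not s ∨ x) ∧ subᵇ ss xs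

eqSᵇ : ∀ {n} → Subset n → Subset n → Bool
eqSᵇ []       []       = true
eqSᵇ (a ∷ as) (b ∷ bs) = ((a ∧ b) ∨ (not a ∧ not b)) ∧ eqSᵇ as bs

-- does S contain the least element of X' ?  (used only to pick one
-- canonical ordered representative of an unordered pair {S, X' \ S})
firstIn : ∀ {n} → Subset n → Subset n → Bool
firstIn []           []       = false
firstIn (true ∷ xs)  (s ∷ ss) = s
firstIn (false ∷ xs) (s ∷ ss) = firstIn xs ss

Rect : ℕ → ℕ → Set
Rect nx ny = Subset nx × Subset ny

eqRᵇ : ∀ {nx ny} → Rect nx ny → Rect nx ny → Bool
eqRᵇ (a , b) (c , d) = eqSᵇ a c ∧ eqSᵇ b d

rects : (nx ny : ℕ) → List (Rect nx ny)
rects nx ny =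
  concatMap (λ X' → map (X' ,_) (filterᵇ nonemptyᵇ (allSubsets ny)))
            (filterᵇ nonemptyᵇ (allSubsets nx))

fullR : ∀ {nx ny} → Rect nx ny
fullR = ⊤ , ⊤

cellIn : ∀ {nx ny} → Fin nx → Fin ny → Rect nx ny → Bool
cellIn i j (X' , Y') = lookup X' i ∧ lookup Y' j

mono : ∀ {nx ny nz} → Rel3 nx ny nz → Rect nx ny → Bool
mono {nx} {ny} {nz} T R =
  any (λ z → all (λ i → all (λ j → not (cellIn i j R) ∨ T i j z) (allFin ny)) (allFin nx))
      (allFin nz)

monoRects : ∀ {nx ny nz} → Rel3 nx ny nz → List (Rect nx ny)
monoRects {nx} {ny} T = filterᵇ (mono T) (rects nx ny)

-- Partitions 𝒫(R): each unordered pair {A , B} is listed exactly once,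
-- as an ordered pair (A , B) where A contains the least row (resp. column)
-- of R.

rowParts : ∀ {nx ny} → Rect nx ny → List (Rect nx ny × Rect nx ny)
rowParts {nx} (X' , Y') =
  map (λ S → ((S , Y') , (X' ∩ ∁ S , Y')))
      (filterᵇ (λ S → subᵇ S X' ∧ nonemptyᵇ S ∧ nonemptyᵇ (X' ∩ ∁ S) ∧ firstIn X' S)
               (allSubsets nx))

colParts : ∀ {nx ny} → Rect nx ny → List (Rect nx ny × Rect nx ny)
colParts {nx} {ny} (X' , Y') =
  map (λ S → ((X' , S) , (X' , Y' ∩ ∁ S)))
      (filterᵇ (λ S → subᵇ S Y' ∧ nonemptyᵇ S ∧ nonemptyᵇ (Y' ∩ ∁ S) ∧ firstIn Y' S)
               (allSubsets ny))

parts : ∀ {nx ny} → Rect nx ny → List (Rect nx ny × Rect nx ny)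
parts R = rowParts R ++ colParts R

Γ : (nx ny : ℕ) → List (Rect nx ny × (Rect nx ny × Rect nx ny))
Γ nx ny = concatMap (λ R → map (R ,_) (parts R)) (rects nx ny)

inPartᵇ : ∀ {nx ny} → Rect nx ny → Rect nx ny × Rect nx ny → Bool
inPartᵇ R (A , B) = eqRᵇ R A ∨ eqRᵇ R B

-- The program PN(T) over a carrier A (ℕ for the IP, ℚ for the LP).
-- x is indexed by rectangles (only its values on ℳ(T) enter the program),
-- y is indexed by triples (R , P) (only its values on Γ(T) enter).

module Program {A : Set} (_+_ : A → A → A) (0# 1# : A)
               {nx ny nz : ℕ} (T : Rel3 nx ny nz) where

  sumOver : {B : Set} → List B → (B → A) → A
  sumOver l f = foldr (λ b acc → f b + acc) 0# l

  objective : (Rect nx ny → A) → A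
  objective x = sumOver (monoRects T) x

  Feasible : (Rect nx ny → A) → (Rect nx ny × (Rect nx ny × Rect nx ny) → A) → Set
  Feasible x y =
    (∀ (i : Fin nx) (j : Fin ny) →
       sumOver (filterᵇ (cellIn i j) (monoRects T)) x ≡ 1#)
    ×
    (∀ (R : Rect nx ny) → R ∈ rects nx ny → R ≢ fullR →
       sumOver (filterᵇ (λ g → inPartᵇ R (proj₂ g)) (Γ nx ny)) y
       ≡ (if mono T R
            then sumOver (filterᵇ (λ g → eqRᵇ (proj₁ g) R) (Γ nx ny)) y + x R
            else sumOver (filterᵇ (λ g → eqRᵇ (proj₁ g) R) (Γ nx ny)) y))

IPOptimalValue : ∀ {nx ny nz} → Rel3 nx ny nz → ℕ → Set
IPOptimalValue {nx} {ny} T k =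
  (Σ (Rect nx ny → ℕ) λ x → Σ (Rect nx ny × (Rect nx ny × Rect nx ny) → ℕ) λ y →
      Feasible x y × objective x ≡ k)
  × (∀ x y → Feasible x y → k ℕ.≤ objective x)
  where open Program ℕ._+_ 0 1 T

NonNeg : {B : Set} → (B → ℚ) → Set
NonNeg f = ∀ b → 0ℚ ℚ.≤ f b

LPOptimalValue : ∀ {nx ny nz} → Rel3 nx ny nz → ℕ → Set
LPOptimalValue {nx} {ny} T k =
  (Σ (Rect nx ny → ℚ) λ x → Σ (Rect nx ny × (Rect nx ny × Rect nx ny) → ℚ) λ y →
      NonNeg x × NonNeg y × Feasible x y × objective x ≡ (+ k) ℚ./ 1)
  × (∀ x y → NonNeg x → NonNeg y → Feasible x y → (+ k) ℚ./ 1 ℚ.≤ objective x)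
  where open Program ℚ._+_ 0ℚ 1ℚ T

data Tree {nx ny : ℕ} : Rect nx ny → Set where
  leaf : (R : Rect nx ny) → Tree R
  node : {R A B : Rect nx ny} → (A , B) ∈ parts R → Tree A → Tree B → Tree R

leaves : ∀ {nx ny} {R : Rect nx ny} → Tree R → List (Rect nx ny)
leaves (leaf R)     = R ∷ []
leaves (node _ l r) = leaves l ++ leaves r

Disjoint : ∀ {nx ny} → Rect nx ny → Rect nx ny → Set
Disjoint {nx} {ny} R R' = ∀ (i : Fin nx) (j : Fin ny) →
  cellIn i j R ≡ true → cellIn i j R' ≡ false

RecPartitions : ∀ {nx ny nz} → Rel3 nx ny nz → List (Rect nx ny) → Set
RecPartitions {nx} {ny} T ℛ =
  All (_∈ rects nx ny) ℛ
  × All (λ R → mono T R ≡ true) ℛ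
  × AllPairs Disjoint ℛ
  × (∀ (i : Fin nx) (j : Fin ny) → Any (λ R → cellIn i j R ≡ true) ℛ)
  × Σ (Tree fullR) (λ t → leaves t ↭ ℛ)

ProtocolPartitionNumber : ∀ {nx ny nz} → Rel3 nx ny nz → ℕ → Set
ProtocolPartitionNumber T k =
  (Σ _ λ ℛ → RecPartitions T ℛ × length ℛ ≡ k)
  × (∀ ℛ → RecPartitions T ℛ → k ℕ.≤ length ℛ)

module Submission where

-- For a rectangle R let minLeaves R be the least number of leaves of a protocol tree for R whose
-- leaves are all monochromatic (a dynamic program over partitions; minLeaves C_T = C^P(T)).  It is
-- 1 on monochromatic rectangles and subadditive along partitions.  An optimal tree yields an
-- integral solution of PN(T) of value C^P(T): x_R counts the leaves equal to R and y_{V,P} the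
-- internal vertices (V, P).  Conversely take any fractional solution (x, y) and let out be the
-- y-flow leaving C_T.  Summing the flow constraints of the R ≠ C_T with weights f(R) shows that
-- f(C_T)·out is at most, for subadditive f, and at least, for superadditive f, the mass
-- Σ f(R) x_R over monochromatic R ≠ C_T.  With f = minLeaves this bounds C^P(T)·out by the
-- objective without its C_T term; with f the indicator of one fixed cell, which is additive, the
-- covering constraint of that cell gives 1 ≤ x_{C_T} + out.  Together the objective is at least
-- C^P(T).

open import Defs

open import Algebra.Bundles using (CommutativeMonoid)
import Algebra.Properties.CommutativeMonoid.Mult as MultProperties
import Algebra.Properties.CommutativeSemigroup as CommutativeSemigroupProperties
open import Data.Bool using (Bool; true; false; _∧_; _∨_; not; if_then_else_)
open import Data.Bool.ListAction using (any; all)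
open import Data.Bool.Properties using (T-≡; ∧-zeroʳ; ∨-zeroʳ; ∧-distribʳ-∨; ∧-distribˡ-∨)
open import Data.Empty using (⊥-elim)
open import Data.Fin using (Fin) renaming (zero to fzero; suc to fsuc)
open import Data.Fin.Subset using (Subset; _∩_; ∁; ⊤)
open import Data.Integer as ℤ using (+_)
import Data.Integer.Properties as ℤP
open import Data.List using (List; []; _∷_; _++_; map; concatMap; filterᵇ; foldr; allFin; length)
open import Data.List.Membership.Propositional using (_∈_; lose; find; mapWith∈)
open import Data.List.Membership.Propositional.Properties
  using (∈-filter⁺; ∈-filter⁻; ∈-concatMap⁺; ∈-concatMap⁻; ∈-map⁺; ∈-map⁻; ∈-++⁺ˡ; ∈-++⁺ʳ; ∈-++⁻; ∈-allFin)
open import Data.List.Properties using (length-++)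
open import Data.List.Relation.Binary.Permutation.Propositional using (↭-refl; ↭-sym)
open import Data.List.Relation.Binary.Permutation.Propositional.Properties using (All-resp-↭; ↭-length)
open import Data.List.Relation.Unary.All using (All; []; _∷_)
  renaming (tabulate to All-tabulate; lookup to All-lookup; map to All-map)
import Data.List.Relation.Unary.All.Properties as All
open import Data.List.Relation.Unary.AllPairs using (AllPairs; []; _∷_)
open import Data.List.Relation.Unary.Any using (Any; here; there)
open import Data.List.Relation.Unary.Any.Properties using (¬Any[]; mapWith∈⁺; mapWith∈⁻)
open import Data.Nat as ℕ using (ℕ; zero; suc; _≤_; _<_; z≤n; s≤s)
import Data.Nat.Coprimality as Coprime
import Data.Nat.Properties as ℕP
open import Data.Nat.Solver using (module +-*-Solver)
open import Data.List.Extrema ℕP.≤-totalOrder using (argmin; f[argmin]≤v⁺; argmin-all)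
open import Data.Product using (Σ; ∃; _×_; _,_; proj₁; proj₂)
open import Data.Rational as ℚ using (ℚ; 0ℚ; 1ℚ; mkℚ)
import Data.Rational.Properties as ℚP
open import Data.Sum using (inj₁; inj₂)
open import Data.Unit using (tt) renaming (⊤ to 𝟙)
open import Data.Vec using ([]; _∷_; lookup; replicate)
open import Data.Vec.Properties using (lookup-zipWith; lookup-map; lookup-replicate)
open import Function using (_∘_; Equivalence)
open import Relation.Binary.PropositionalEquality
  using (_≡_; _≢_; refl; sym; trans; cong; cong₂; subst; subst₂; isEquivalence; module ≡-Reasoning)
import Relation.Binary.Reasoning.Base.Double as DoubleReasoning
open import Relation.Binary.Structures using (IsPreorder)
open import Level using (0ℓ)
open import Relation.Nullary.Decidable using (T?)

⟦_⟧ : Bool → ℕ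
⟦ true ⟧ = 1
⟦ false ⟧ = 0

record CancellativeOrderedMonoid : Set₁ where
  infixr 6 _⊕_
  infix 4 _≼_
  field
    Carrier : Set
    _⊕_ : Carrier → Carrier → Carrier
    ε : Carrier
    _≼_ : Carrier → Carrier → Set
    ⊕-assoc : ∀ a b c → (a ⊕ b) ⊕ c ≡ a ⊕ (b ⊕ c)
    ⊕-comm : ∀ a b → a ⊕ b ≡ b ⊕ a
    ⊕-identityˡ : ∀ a → ε ⊕ a ≡ a
    ≼-refl : ∀ {a} → a ≼ a
    ≼-trans : ∀ {a b c} → a ≼ b → b ≼ c → a ≼ c
    ⊕-mono-≼ : ∀ {a b c d} → a ≼ b → c ≼ d → a ⊕ c ≼ b ⊕ d
    ⊕-cancelˡ-≼ : ∀ a {b c} → a ⊕ b ≼ a ⊕ c → b ≼ c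

∑ℕ : {B : Set} → List B → (B → ℕ) → ℕ
∑ℕ l f = foldr (λ b acc → f b ℕ.+ acc) 0 l

ℕ-monoid : CancellativeOrderedMonoid
ℕ-monoid = record
  { Carrier = ℕ ; _⊕_ = ℕ._+_ ; ε = 0 ; _≼_ = _≤_
  ; ⊕-assoc = ℕP.+-assoc ; ⊕-comm = ℕP.+-comm ; ⊕-identityˡ = ℕP.+-identityˡ
  ; ≼-refl = ℕP.≤-refl ; ≼-trans = ℕP.≤-trans ; ⊕-mono-≼ = ℕP.+-mono-≤
  ; ⊕-cancelˡ-≼ = λ a {b} {c} → ℕP.+-cancelˡ-≤ a b c
  }

ℚ+-cancelˡ-≤ : ∀ a {b c} → a ℚ.+ b ℚ.≤ a ℚ.+ c → b ℚ.≤ c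
ℚ+-cancelˡ-≤ a {b} {c} a+b≤a+c = subst₂ ℚ._≤_ (-a+[a+z]≡z b) (-a+[a+z]≡z c) (ℚP.+-monoʳ-≤ (ℚ.- a) a+b≤a+c)
  where
  -a+[a+z]≡z : ∀ z → ℚ.- a ℚ.+ (a ℚ.+ z) ≡ z
  -a+[a+z]≡z z = trans (sym (ℚP.+-assoc (ℚ.- a) a z)) (trans (cong (ℚ._+ z) (ℚP.+-inverseˡ a)) (ℚP.+-identityˡ z))

ℚ-monoid : CancellativeOrderedMonoid
ℚ-monoid = record
  { Carrier = ℚ ; _⊕_ = ℚ._+_ ; ε = 0ℚ ; _≼_ = ℚ._≤_
  ; ⊕-assoc = ℚP.+-assoc ; ⊕-comm = ℚP.+-comm ; ⊕-identityˡ = ℚP.+-identityˡ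
  ; ≼-refl = ℚP.≤-refl ; ≼-trans = ℚP.≤-trans ; ⊕-mono-≼ = ℚP.+-mono-≤
  ; ⊕-cancelˡ-≼ = ℚ+-cancelˡ-≤
  }

module Sums (M : CancellativeOrderedMonoid) where
  open CancellativeOrderedMonoid M

  -- The same fold as Program.sumOver, so the constraints of PN(T) are literally such sums.
  ∑ : {B : Set} → List B → (B → Carrier) → Carrier
  ∑ l f = foldr (λ b acc → f b ⊕ acc) ε l

  ≼-reflexive : ∀ {a b} → a ≡ b → a ≼ b
  ≼-reflexive refl = ≼-refl

  ≼-isPreorder : IsPreorder _≡_ _≼_
  ≼-isPreorder = record { isEquivalence = isEquivalence
                        ; reflexive = ≼-reflexive ; trans = ≼-trans }

  module ≼-Reasoning = DoubleReasoning ≼-isPreorder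

  ⊕-identityʳ : ∀ a → a ⊕ ε ≡ a
  ⊕-identityʳ a = trans (⊕-comm a ε) (⊕-identityˡ a)

  ⊕-commutativeMonoid : CommutativeMonoid 0ℓ 0ℓ
  ⊕-commutativeMonoid = record
    { isCommutativeMonoid = record
      { isMonoid = record
        { isSemigroup = record
          { isMagma = record { isEquivalence = isEquivalence ; ∙-cong = cong₂ _⊕_ }
          ; assoc = ⊕-assoc }
        ; identity = ⊕-identityˡ , ⊕-identityʳ }
      ; comm = ⊕-comm } }

  open MultProperties ⊕-commutativeMonoid public
    using (×-homo-1; ×-homo-+; ×-assocˡ; ×-distrib-+) renaming (_×_ to infixr 7 _·_)
  open CommutativeSemigroupProperties (CommutativeMonoid.commutativeSemigroup ⊕-commutativeMonoid)
    using (interchange)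

  ·-zeroʳ : ∀ m → m · ε ≡ ε
  ·-zeroʳ zero = refl
  ·-zeroʳ (suc m) = trans (⊕-identityˡ _) (·-zeroʳ m)

  ·-swap : ∀ m n a → m · n · a ≡ n · m · a
  ·-swap m n a = trans (×-assocˡ a m n) (trans (cong (_· a) (ℕP.*-comm m n)) (sym (×-assocˡ a n m)))

  ·-monoʳ : ∀ m {a b} → a ≼ b → m · a ≼ m · b
  ·-monoʳ zero a≼b = ≼-refl
  ·-monoʳ (suc m) a≼b = ⊕-mono-≼ a≼b (·-monoʳ m a≼b)

  ·-monoˡ : ∀ {m n} a → ε ≼ a → m ≤ n → m · a ≼ n · a
  ·-monoˡ {zero} {zero} a ε≼a m≤n = ≼-refl
  ·-monoˡ {zero} {suc n} a ε≼a m≤n =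
    ≼-trans (≼-reflexive (sym (⊕-identityˡ ε))) (⊕-mono-≼ ε≼a (·-monoˡ {zero} {n} a ε≼a z≤n))
  ·-monoˡ {suc m} {suc n} a ε≼a (s≤s m≤n) = ⊕-mono-≼ ≼-refl (·-monoˡ a ε≼a m≤n)

  ∑-cong : {B : Set} (l : List B) {f g : B → Carrier} → (∀ b → b ∈ l → f b ≡ g b) → ∑ l f ≡ ∑ l g
  ∑-cong [] f≡g = refl
  ∑-cong (b ∷ l) f≡g = cong₂ _⊕_ (f≡g b (here refl)) (∑-cong l (λ b′ b′∈l → f≡g b′ (there b′∈l)))

  ∑-cong′ : {B : Set} (l : List B) {f g : B → Carrier} → (∀ b → f b ≡ g b) → ∑ l f ≡ ∑ l g
  ∑-cong′ l f≡g = ∑-cong l (λ b _ → f≡g b)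

  ∑-mono : {B : Set} (l : List B) {f g : B → Carrier} → (∀ b → b ∈ l → f b ≼ g b) → ∑ l f ≼ ∑ l g
  ∑-mono [] f≼g = ≼-refl
  ∑-mono (b ∷ l) f≼g = ⊕-mono-≼ (f≼g b (here refl)) (∑-mono l (λ b′ b′∈l → f≼g b′ (there b′∈l)))

  ∑-zero : {B : Set} (l : List B) → ∑ l (λ _ → ε) ≡ ε
  ∑-zero [] = refl
  ∑-zero (b ∷ l) = trans (⊕-identityˡ _) (∑-zero l)

  ∑-⊕ : {B : Set} (l : List B) (f g : B → Carrier) → ∑ l (λ b → f b ⊕ g b) ≡ ∑ l f ⊕ ∑ l g
  ∑-⊕ [] f g = sym (⊕-identityˡ ε)
  ∑-⊕ (b ∷ l) f g = trans (cong ((f b ⊕ g b) ⊕_) (∑-⊕ l f g)) (interchange (f b) (g b) _ _)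

  ·-∑ : {B : Set} (m : ℕ) (l : List B) (f : B → Carrier) → m · ∑ l f ≡ ∑ l (λ b → m · f b)
  ·-∑ m [] f = ·-zeroʳ m
  ·-∑ m (b ∷ l) f = trans (×-distrib-+ (f b) _ m) (cong (m · f b ⊕_) (·-∑ m l f))

  ∑ℕ-· : {B : Set} (l : List B) (c : B → ℕ) (a : Carrier) → ∑ℕ l c · a ≡ ∑ l (λ b → c b · a)
  ∑ℕ-· [] c a = refl
  ∑ℕ-· (b ∷ l) c a = trans (×-homo-+ a (c b) (∑ℕ l c)) (cong (c b · a ⊕_) (∑ℕ-· l c a))

  ∑-comm : {B C : Set} (l₁ : List B) (l₂ : List C) (h : B → C → Carrier) →
           ∑ l₁ (λ b → ∑ l₂ (h b)) ≡ ∑ l₂ (λ c → ∑ l₁ (λ b → h b c))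
  ∑-comm [] l₂ h = sym (∑-zero l₂)
  ∑-comm (b ∷ l₁) l₂ h = trans (cong (∑ l₂ (h b) ⊕_) (∑-comm l₁ l₂ h))
                               (sym (∑-⊕ l₂ (h b) (λ c → ∑ l₁ (λ b′ → h b′ c))))

  ∑-++ : {B : Set} (l₁ l₂ : List B) (f : B → Carrier) → ∑ (l₁ ++ l₂) f ≡ ∑ l₁ f ⊕ ∑ l₂ f
  ∑-++ [] l₂ f = sym (⊕-identityˡ _)
  ∑-++ (b ∷ l₁) l₂ f = trans (cong (f b ⊕_) (∑-++ l₁ l₂ f)) (sym (⊕-assoc _ _ _))

  ∑-map : {B C : Set} (g : B → C) (l : List B) (f : C → Carrier) → ∑ (map g l) f ≡ ∑ l (λ b → f (g b))
  ∑-map g [] f = refl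
  ∑-map g (b ∷ l) f = cong (f (g b) ⊕_) (∑-map g l f)

  ∑-concatMap : {B C : Set} (g : B → List C) (l : List B) (f : C → Carrier) →
                ∑ (concatMap g l) f ≡ ∑ l (λ b → ∑ (g b) f)
  ∑-concatMap g [] f = refl
  ∑-concatMap g (b ∷ l) f = trans (∑-++ (g b) (concatMap g l) f) (cong (∑ (g b) f ⊕_) (∑-concatMap g l f))

  ∑-filterᵇ : {B : Set} (p : B → Bool) (l : List B) (f : B → Carrier) →
              ∑ (filterᵇ p l) f ≡ ∑ l (λ b → ⟦ p b ⟧ · f b)
  ∑-filterᵇ p [] f = refl
  ∑-filterᵇ p (b ∷ l) f with p b
  ... | true = cong₂ _⊕_ (sym (×-homo-1 (f b))) (∑-filterᵇ p l f)
  ... | false = trans (∑-filterᵇ p l f) (sym (⊕-identityˡ _))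

∧-≡true⁻ : ∀ {a b} → a ∧ b ≡ true → a ≡ true × b ≡ true
∧-≡true⁻ {true} {true} refl = refl , refl

true≢false : true ≢ false
true≢false ()

∈-filterᵇ⁺ : {A : Set} (p : A → Bool) {x : A} {l : List A} → x ∈ l → p x ≡ true → x ∈ filterᵇ p l
∈-filterᵇ⁺ p x∈l px = ∈-filter⁺ (T? ∘ p) x∈l (Equivalence.from T-≡ px)

∈-filterᵇ⁻ : {A : Set} (p : A → Bool) {x : A} (l : List A) → x ∈ filterᵇ p l → x ∈ l × p x ≡ true
∈-filterᵇ⁻ p l x∈ with ∈-filter⁻ (T? ∘ p) {xs = l} x∈
... | x∈l , px = x∈l , Equivalence.to T-≡ px

eqSᵇ-refl : ∀ {n} (a : Subset n) → eqSᵇ a a ≡ true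
eqSᵇ-refl [] = refl
eqSᵇ-refl (true ∷ a) = eqSᵇ-refl a
eqSᵇ-refl (false ∷ a) = eqSᵇ-refl a

eqSᵇ⇒≡ : ∀ {n} (a b : Subset n) → eqSᵇ a b ≡ true → a ≡ b
eqSᵇ⇒≡ [] [] e = refl
eqSᵇ⇒≡ (true ∷ a) (true ∷ b) e = cong (true ∷_) (eqSᵇ⇒≡ a b e)
eqSᵇ⇒≡ (false ∷ a) (false ∷ b) e = cong (false ∷_) (eqSᵇ⇒≡ a b e)

eqSᵇ-sym : ∀ {n} (a b : Subset n) → eqSᵇ a b ≡ eqSᵇ b a
eqSᵇ-sym [] [] = refl
eqSᵇ-sym (true ∷ a) (true ∷ b) = eqSᵇ-sym a b
eqSᵇ-sym (false ∷ a) (false ∷ b) = eqSᵇ-sym a b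
eqSᵇ-sym (true ∷ a) (false ∷ b) = refl
eqSᵇ-sym (false ∷ a) (true ∷ b) = refl

lookup-∩∁ : ∀ {n} (a b : Subset n) i → lookup (a ∩ ∁ b) i ≡ lookup a i ∧ not (lookup b i)
lookup-∩∁ a b i = trans (lookup-zipWith _∧_ i a (∁ b)) (cong (lookup a i ∧_) (lookup-map i not b))

lookup-⊤ : ∀ {n} (i : Fin n) → lookup (⊤ {n}) i ≡ true
lookup-⊤ i = lookup-replicate i true

subᵇ⇒⊆ : ∀ {n} (s x : Subset n) → subᵇ s x ≡ true → ∀ i → lookup s i ≡ true → lookup x i ≡ true
subᵇ⇒⊆ (true ∷ s) (true ∷ x) e fzero h = refl
subᵇ⇒⊆ (b ∷ s) (x ∷ xs) e (fsuc i) h = subᵇ⇒⊆ s xs (proj₂ (∧-≡true⁻ {not b ∨ x} e)) i h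

nonemptyᵇ⇒∃ : ∀ {n} (s : Subset n) → nonemptyᵇ s ≡ true → Σ (Fin n) λ i → lookup s i ≡ true
nonemptyᵇ⇒∃ (true ∷ s) e = fzero , refl
nonemptyᵇ⇒∃ (false ∷ s) e with nonemptyᵇ⇒∃ s e
... | i , s∋i = fsuc i , s∋i

∃⇒nonemptyᵇ : ∀ {n} (s : Subset n) i → lookup s i ≡ true → nonemptyᵇ s ≡ true
∃⇒nonemptyᵇ (true ∷ s) i h = refl
∃⇒nonemptyᵇ (false ∷ s) (fsuc i) h = ∃⇒nonemptyᵇ s i h

∈-allSubsets : ∀ {n} (s : Subset n) → s ∈ allSubsets n
∈-allSubsets [] = here refl
∈-allSubsets {suc n} (true ∷ s) = ∈-++⁺ˡ (∈-map⁺ (true ∷_) (∈-allSubsets s))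
∈-allSubsets {suc n} (false ∷ s) = ∈-++⁺ʳ (map (true ∷_) (allSubsets n)) (∈-map⁺ (false ∷_) (∈-allSubsets s))

card : ∀ {n} → Subset n → ℕ
card [] = 0
card (true ∷ s) = suc (card s)
card (false ∷ s) = card s

card≤ : ∀ {n} (s : Subset n) → card s ≤ n
card≤ [] = z≤n
card≤ (true ∷ s) = s≤s (card≤ s)
card≤ (false ∷ s) = ℕP.m≤n⇒m≤1+n (card≤ s)

card-⊤ : ∀ n → card (⊤ {n}) ≡ n
card-⊤ zero = refl
card-⊤ (suc n) = cong suc (card-⊤ n)

card-nonempty : ∀ {n} (s : Subset n) → nonemptyᵇ s ≡ true → 0 < card s
card-nonempty (true ∷ s) e = s≤s z≤n
card-nonempty (false ∷ s) e = card-nonempty s e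

card-split : ∀ {n} (s x : Subset n) → subᵇ s x ≡ true → card s ℕ.+ card (x ∩ ∁ s) ≡ card x
card-split [] [] e = refl
card-split (true ∷ s) (true ∷ x) e = cong suc (card-split s x e)
card-split (false ∷ s) (true ∷ x) e = trans (ℕP.+-suc (card s) _) (cong suc (card-split s x e))
card-split (false ∷ s) (false ∷ x) e = card-split s x e

nonemptyRᵇ : ∀ {nx ny} → Rect nx ny → Bool
nonemptyRᵇ (X , Y) = nonemptyᵇ X ∧ nonemptyᵇ Y

∥_∥ : ∀ {nx ny} → Rect nx ny → ℕ
∥ X , Y ∥ = card X ℕ.+ card Y

eqRᵇ-refl : ∀ {nx ny} (R : Rect nx ny) → eqRᵇ R R ≡ true
eqRᵇ-refl (X , Y) rewrite eqSᵇ-refl X | eqSᵇ-refl Y = refl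

eqRᵇ⇒≡ : ∀ {nx ny} (R Q : Rect nx ny) → eqRᵇ R Q ≡ true → R ≡ Q
eqRᵇ⇒≡ (X , Y) (X′ , Y′) e with ∧-≡true⁻ {eqSᵇ X X′} e
... | eX , eY = cong₂ _,_ (eqSᵇ⇒≡ X X′ eX) (eqSᵇ⇒≡ Y Y′ eY)

eqRᵇ-sym : ∀ {nx ny} (R Q : Rect nx ny) → eqRᵇ R Q ≡ eqRᵇ Q R
eqRᵇ-sym (X , Y) (X′ , Y′) = cong₂ _∧_ (eqSᵇ-sym X X′) (eqSᵇ-sym Y Y′)

≢⇒eqRᵇ≡false : ∀ {nx ny} (R Q : Rect nx ny) → R ≢ Q → eqRᵇ R Q ≡ false
≢⇒eqRᵇ≡false R Q R≢Q with eqRᵇ R Q in e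
... | true = ⊥-elim (R≢Q (eqRᵇ⇒≡ R Q e))
... | false = refl

eqRᵇ≡false⇒≢ : ∀ {nx ny} (R Q : Rect nx ny) → eqRᵇ R Q ≡ false → R ≢ Q
eqRᵇ≡false⇒≢ R Q R≠Q refl = true≢false (trans (sym (eqRᵇ-refl R)) R≠Q)

nonemptyR-full : ∀ {nx ny} → Fin nx → Fin ny → nonemptyRᵇ (fullR {nx} {ny}) ≡ true
nonemptyR-full i j rewrite ∃⇒nonemptyᵇ ⊤ i (lookup-⊤ i) | ∃⇒nonemptyᵇ ⊤ j (lookup-⊤ j) = refl

cellIn-full : ∀ {nx ny} (i : Fin nx) (j : Fin ny) → cellIn i j (fullR {nx} {ny}) ≡ true
cellIn-full i j rewrite lookup-⊤ i | lookup-⊤ j = refl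

∥R∥≤∥full∥ : ∀ {nx ny} (R : Rect nx ny) → ∥ R ∥ ≤ ∥ fullR {nx} {ny} ∥
∥R∥≤∥full∥ {nx} {ny} (X , Y) =
  subst (∥ X , Y ∥ ≤_) (sym (cong₂ ℕ._+_ (card-⊤ nx) (card-⊤ ny))) (ℕP.+-mono-≤ (card≤ X) (card≤ Y))

∈-rects : ∀ {nx ny} (R : Rect nx ny) → nonemptyRᵇ R ≡ true → R ∈ rects nx ny
∈-rects {nx} {ny} (X , Y) ne with ∧-≡true⁻ {nonemptyᵇ X} ne
... | neX , neY =
  ∈-concatMap⁺ (λ X′ → map (X′ ,_) (filterᵇ nonemptyᵇ (allSubsets ny)))
    (lose (∈-filterᵇ⁺ nonemptyᵇ (∈-allSubsets X) neX) (∈-map⁺ (X ,_) (∈-filterᵇ⁺ nonemptyᵇ (∈-allSubsets Y) neY)))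

rects-nonempty : ∀ {nx ny} (R : Rect nx ny) → R ∈ rects nx ny → nonemptyRᵇ R ≡ true
rects-nonempty {nx} {ny} R R∈
  with find (∈-concatMap⁻ (λ X′ → map (X′ ,_) (filterᵇ nonemptyᵇ (allSubsets ny))) {xs = filterᵇ nonemptyᵇ (allSubsets nx)} R∈)
... | X , X∈ , R∈X with ∈-map⁻ (X ,_) R∈X
... | Y , Y∈ , refl = cong₂ _∧_ (proj₂ (∈-filterᵇ⁻ nonemptyᵇ (allSubsets nx) X∈))
                                (proj₂ (∈-filterᵇ⁻ nonemptyᵇ (allSubsets ny) Y∈))

splitsᵇ : ∀ {n} → Subset n → Subset n → Bool
splitsᵇ X S = subᵇ S X ∧ nonemptyᵇ S ∧ nonemptyᵇ (X ∩ ∁ S) ∧ firstIn X S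

splitsᵇ⁻ : ∀ {n} (X S : Subset n) → splitsᵇ X S ≡ true →
           subᵇ S X ≡ true × nonemptyᵇ S ≡ true × nonemptyᵇ (X ∩ ∁ S) ≡ true
splitsᵇ⁻ X S c with ∧-≡true⁻ {subᵇ S X} c
... | S⊆X , c′ with ∧-≡true⁻ {nonemptyᵇ S} c′
... | neS , c″ = S⊆X , neS , proj₁ (∧-≡true⁻ {nonemptyᵇ (X ∩ ∁ S)} c″)

split-covers : ∀ {n} (X S : Subset n) → subᵇ S X ≡ true → ∀ i → lookup X i ≡ lookup S i ∨ lookup (X ∩ ∁ S) i
split-covers X S S⊆X i rewrite lookup-∩∁ X S i with lookup S i in S∋i | lookup X i in X∋i
... | true | true = refl
... | true | false = ⊥-elim (true≢false (trans (sym (subᵇ⇒⊆ S X S⊆X i S∋i)) X∋i))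
... | false | true = refl
... | false | false = refl

split-disjoint : ∀ {n} (X S : Subset n) i → lookup S i ∧ lookup (X ∩ ∁ S) i ≡ false
split-disjoint X S i rewrite lookup-∩∁ X S i with lookup S i
... | true = ∧-zeroʳ (lookup X i)
... | false = refl

split-distinct : ∀ {n} (X S : Subset n) → nonemptyᵇ S ≡ true → S ≢ X ∩ ∁ S
split-distinct X S neS S≡ with nonemptyᵇ⇒∃ S neS
... | i , S∋i = true≢false (trans (sym (cong₂ _∧_ S∋i (trans (cong (λ v → lookup v i) (sym S≡)) S∋i)))
                                  (split-disjoint X S i))

split-smallerˡ : ∀ {n} (X S : Subset n) → subᵇ S X ≡ true → nonemptyᵇ (X ∩ ∁ S) ≡ true → card S < card X
split-smallerˡ X S S⊆X neR = subst (card S <_) (card-split S X S⊆X) (ℕP.m<m+n (card S) (card-nonempty (X ∩ ∁ S) neR))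

split-smallerʳ : ∀ {n} (X S : Subset n) → subᵇ S X ≡ true → nonemptyᵇ S ≡ true → card (X ∩ ∁ S) < card X
split-smallerʳ X S S⊆X neS =
  subst (card (X ∩ ∁ S) <_) (card-split S X S⊆X) (ℕP.m<n+m (card (X ∩ ∁ S)) (card-nonempty S neS))

∧-disjointʳ : ∀ a b c → a ∧ b ≡ false → (a ∧ c) ∧ (b ∧ c) ≡ false
∧-disjointʳ true true c ()
∧-disjointʳ true false c e = ∧-zeroʳ c
∧-disjointʳ false b c e = refl

∧-disjointˡ : ∀ a b c → b ∧ c ≡ false → (a ∧ b) ∧ (a ∧ c) ≡ false
∧-disjointˡ true b c e = e
∧-disjointˡ false b c e = refl

record Splits {nx ny : ℕ} (V A B : Rect nx ny) : Set where
  field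
    covers : ∀ i j → cellIn i j V ≡ cellIn i j A ∨ cellIn i j B
    disjoint : ∀ i j → cellIn i j A ∧ cellIn i j B ≡ false
    distinct : A ≢ B
    nonemptyˡ : nonemptyRᵇ V ≡ true → nonemptyRᵇ A ≡ true
    nonemptyʳ : nonemptyRᵇ V ≡ true → nonemptyRᵇ B ≡ true
    smallerˡ : ∥ A ∥ < ∥ V ∥
    smallerʳ : ∥ B ∥ < ∥ V ∥

  ≢fullˡ : A ≢ fullR
  ≢fullˡ A≡full = ℕP.<⇒≱ smallerˡ (subst (λ R → ∥ V ∥ ≤ ∥ R ∥) (sym A≡full) (∥R∥≤∥full∥ V))

  ≢fullʳ : B ≢ fullR
  ≢fullʳ B≡full = ℕP.<⇒≱ smallerʳ (subst (λ R → ∥ V ∥ ≤ ∥ R ∥) (sym B≡full) (∥R∥≤∥full∥ V))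

rowSplit : ∀ {nx ny} → Subset nx → Subset ny → Subset nx → Rect nx ny × Rect nx ny
rowSplit X Y S = (S , Y) , (X ∩ ∁ S , Y)

colSplit : ∀ {nx ny} → Subset nx → Subset ny → Subset ny → Rect nx ny × Rect nx ny
colSplit X Y S = (X , S) , (X , Y ∩ ∁ S)

rowSplit-Splits : ∀ {nx ny} (X S : Subset nx) (Y : Subset ny) → splitsᵇ X S ≡ true →
                  Splits (X , Y) (S , Y) (X ∩ ∁ S , Y)
rowSplit-Splits X S Y c with splitsᵇ⁻ X S c
... | S⊆X , neS , neR = record
  { covers = λ i j → trans (cong (_∧ lookup Y j) (split-covers X S S⊆X i)) (∧-distribʳ-∨ (lookup Y j) (lookup S i) _)
  ; disjoint = λ i j → ∧-disjointʳ (lookup S i) _ (lookup Y j) (split-disjoint X S i)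
  ; distinct = λ eq → split-distinct X S neS (cong proj₁ eq)
  ; nonemptyˡ = λ ne → cong₂ _∧_ neS (proj₂ (∧-≡true⁻ {nonemptyᵇ X} ne))
  ; nonemptyʳ = λ ne → cong₂ _∧_ neR (proj₂ (∧-≡true⁻ {nonemptyᵇ X} ne))
  ; smallerˡ = ℕP.+-monoˡ-< (card Y) (split-smallerˡ X S S⊆X neR)
  ; smallerʳ = ℕP.+-monoˡ-< (card Y) (split-smallerʳ X S S⊆X neS)
  }

colSplit-Splits : ∀ {nx ny} (X : Subset nx) (Y S : Subset ny) → splitsᵇ Y S ≡ true →
                  Splits (X , Y) (X , S) (X , Y ∩ ∁ S)
colSplit-Splits X Y S c with splitsᵇ⁻ Y S c
... | S⊆Y , neS , neR = record
  { covers = λ i j → trans (cong (lookup X i ∧_) (split-covers Y S S⊆Y j)) (∧-distribˡ-∨ (lookup X i) (lookup S j) _)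
  ; disjoint = λ i j → ∧-disjointˡ (lookup X i) (lookup S j) _ (split-disjoint Y S j)
  ; distinct = λ eq → split-distinct Y S neS (cong proj₂ eq)
  ; nonemptyˡ = λ ne → cong₂ _∧_ (proj₁ (∧-≡true⁻ {nonemptyᵇ X} ne)) neS
  ; nonemptyʳ = λ ne → cong₂ _∧_ (proj₁ (∧-≡true⁻ {nonemptyᵇ X} ne)) neR
  ; smallerˡ = ℕP.+-monoʳ-< (card X) (split-smallerˡ Y S S⊆Y neR)
  ; smallerʳ = ℕP.+-monoʳ-< (card X) (split-smallerʳ Y S S⊆Y neS)
  }

parts⇒Splits : ∀ {nx ny} (V A B : Rect nx ny) → (A , B) ∈ parts V → Splits V A B
parts⇒Splits {nx} {ny} (X , Y) A B AB∈ with ∈-++⁻ (rowParts (X , Y)) AB∈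
... | inj₁ AB∈row with ∈-map⁻ (rowSplit X Y) AB∈row
...   | S , S∈ , refl = rowSplit-Splits X S Y (proj₂ (∈-filterᵇ⁻ (splitsᵇ X) (allSubsets nx) S∈))
parts⇒Splits {nx} {ny} (X , Y) A B AB∈ | inj₂ AB∈col with ∈-map⁻ (colSplit X Y) AB∈col
...   | S , S∈ , refl = colSplit-Splits X Y S (proj₂ (∈-filterᵇ⁻ (splitsᵇ Y) (allSubsets ny) S∈))

Branch : ℕ → ℕ → Set
Branch nx ny = Rect nx ny × (Rect nx ny × Rect nx ny)

IsBranch : ∀ {nx ny} → Branch nx ny → Set
IsBranch (V , P) = nonemptyRᵇ V ≡ true × P ∈ parts V

Γ-isBranch : ∀ {nx ny} {g : Branch nx ny} → g ∈ Γ nx ny → IsBranch g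
Γ-isBranch {nx} {ny} g∈ with find (∈-concatMap⁻ (λ R → map (R ,_) (parts R)) {xs = rects nx ny} g∈)
... | V , V∈ , g∈V with ∈-map⁻ (V ,_) g∈V
... | P , P∈ , refl = rects-nonempty V V∈ , P∈

eqPᵇ : ∀ {nx ny} → Rect nx ny × Rect nx ny → Rect nx ny × Rect nx ny → Bool
eqPᵇ (A , B) (A′ , B′) = eqRᵇ A A′ ∧ eqRᵇ B B′

eqΓᵇ : ∀ {nx ny} → Branch nx ny → Branch nx ny → Bool
eqΓᵇ (V , P) (V′ , P′) = eqRᵇ V V′ ∧ eqPᵇ P P′

eqΓᵇ-sym : ∀ {nx ny} (g g′ : Branch nx ny) → eqΓᵇ g g′ ≡ eqΓᵇ g′ g
eqΓᵇ-sym (V , (A , B)) (V′ , (A′ , B′)) rewrite eqRᵇ-sym V V′ | eqRᵇ-sym A A′ | eqRᵇ-sym B B′ = refl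

eqPᵇ-rowSplit : ∀ {nx ny} (X : Subset nx) (Y : Subset ny) S S₀ →
                eqPᵇ (rowSplit X Y S) (rowSplit X Y S₀) ≡ eqSᵇ S S₀
eqPᵇ-rowSplit X Y S S₀ with eqSᵇ S S₀ in e
... | false = refl
... | true with eqSᵇ⇒≡ S S₀ e
...   | refl rewrite eqSᵇ-refl Y | eqSᵇ-refl (X ∩ ∁ S) = refl

eqPᵇ-colSplit : ∀ {nx ny} (X : Subset nx) (Y : Subset ny) S S₀ →
                eqPᵇ (colSplit X Y S) (colSplit X Y S₀) ≡ eqSᵇ S S₀
eqPᵇ-colSplit X Y S S₀ with eqSᵇ S S₀ in e
... | false rewrite ∧-zeroʳ (eqSᵇ X X) = refl
... | true with eqSᵇ⇒≡ S S₀ e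
...   | refl rewrite eqSᵇ-refl X | eqSᵇ-refl (Y ∩ ∁ S) = refl

splitsᵇ⇒≢ : ∀ {n} (X S : Subset n) → splitsᵇ X S ≡ true → eqSᵇ X S ≡ false
splitsᵇ⇒≢ X S c with eqSᵇ X S in e | splitsᵇ⁻ X S c
... | false | _ = refl
... | true | S⊆X , _ , neR = ⊥-elim (ℕP.<-irrefl (cong card (sym (eqSᵇ⇒≡ X S e))) (split-smallerˡ X S S⊆X neR))

eqPᵇ-col-row : ∀ {nx ny} (X : Subset nx) (Y : Subset ny) S S₀ → splitsᵇ X S₀ ≡ true →
               eqPᵇ (colSplit X Y S) (rowSplit X Y S₀) ≡ false
eqPᵇ-col-row X Y S S₀ c rewrite splitsᵇ⇒≢ X S₀ c = refl

eqPᵇ-row-col : ∀ {nx ny} (X : Subset nx) (Y : Subset ny) S S₀ → splitsᵇ Y S₀ ≡ true →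
               eqPᵇ (rowSplit X Y S) (colSplit X Y S₀) ≡ false
eqPᵇ-row-col X Y S S₀ c rewrite splitsᵇ⇒≢ Y S₀ c | ∧-zeroʳ (eqSᵇ S X) = refl

module Picking (M : CancellativeOrderedMonoid) where
  open CancellativeOrderedMonoid M
  open Sums M

  ⟦∧⟧-· : ∀ a b x → ⟦ a ∧ b ⟧ · x ≡ ⟦ a ⟧ · ⟦ b ⟧ · x
  ⟦∧⟧-· true b x = sym (×-homo-1 _)
  ⟦∧⟧-· false b x = refl

  ∑-allSubsets-suc : ∀ {n} (f : Subset (suc n) → Carrier) →
    ∑ (allSubsets (suc n)) f ≡ ∑ (allSubsets n) (λ S → f (true ∷ S)) ⊕ ∑ (allSubsets n) (λ S → f (false ∷ S))
  ∑-allSubsets-suc {n} f = trans (∑-++ (map (true ∷_) (allSubsets n)) _ f)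
                                 (cong₂ _⊕_ (∑-map (true ∷_) (allSubsets n) f) (∑-map (false ∷_) (allSubsets n) f))

  ∑-allSubsets-pick : ∀ {n} (S₀ : Subset n) (f : Subset n → Carrier) →
                      ∑ (allSubsets n) (λ S → ⟦ eqSᵇ S S₀ ⟧ · f S) ≡ f S₀
  ∑-allSubsets-pick [] f = trans (⊕-identityʳ _) (×-homo-1 _)
  ∑-allSubsets-pick {suc n} (true ∷ S₀) f = begin
    ∑ (allSubsets (suc n)) (λ S → ⟦ eqSᵇ S (true ∷ S₀) ⟧ · f S)
      ≡⟨ ∑-allSubsets-suc (λ S → ⟦ eqSᵇ S (true ∷ S₀) ⟧ · f S) ⟩
    ∑ (allSubsets n) (λ S → ⟦ eqSᵇ S S₀ ⟧ · f (true ∷ S)) ⊕ ∑ (allSubsets n) (λ _ → ε)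
      ≡⟨ cong₂ _⊕_ (∑-allSubsets-pick S₀ _) (∑-zero (allSubsets n)) ⟩
    f (true ∷ S₀) ⊕ ε                                                   ≡⟨ ⊕-identityʳ _ ⟩
    f (true ∷ S₀)                                                       ∎
    where open ≡-Reasoning
  ∑-allSubsets-pick {suc n} (false ∷ S₀) f = begin
    ∑ (allSubsets (suc n)) (λ S → ⟦ eqSᵇ S (false ∷ S₀) ⟧ · f S)
      ≡⟨ ∑-allSubsets-suc (λ S → ⟦ eqSᵇ S (false ∷ S₀) ⟧ · f S) ⟩
    ∑ (allSubsets n) (λ _ → ε) ⊕ ∑ (allSubsets n) (λ S → ⟦ eqSᵇ S S₀ ⟧ · f (false ∷ S))
      ≡⟨ cong₂ _⊕_ (∑-zero (allSubsets n)) (∑-allSubsets-pick S₀ _) ⟩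
    ε ⊕ f (false ∷ S₀)                                                  ≡⟨ ⊕-identityˡ _ ⟩
    f (false ∷ S₀)                                                      ∎
    where open ≡-Reasoning

  ∑-filter-allSubsets-pick : ∀ {n} (c : Subset n → Bool) (S₀ : Subset n) (f : Subset n → Carrier) →
    ∑ (filterᵇ c (allSubsets n)) (λ S → ⟦ eqSᵇ S S₀ ⟧ · f S) ≡ ⟦ c S₀ ⟧ · f S₀
  ∑-filter-allSubsets-pick {n} c S₀ f = begin
    ∑ (filterᵇ c (allSubsets n)) (λ S → ⟦ eqSᵇ S S₀ ⟧ · f S)   ≡⟨ ∑-filterᵇ c (allSubsets n) _ ⟩
    ∑ (allSubsets n) (λ S → ⟦ c S ⟧ · ⟦ eqSᵇ S S₀ ⟧ · f S)     ≡⟨ ∑-cong′ (allSubsets n) (λ S → ·-swap ⟦ c S ⟧ ⟦ eqSᵇ S S₀ ⟧ (f S)) ⟩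
    ∑ (allSubsets n) (λ S → ⟦ eqSᵇ S S₀ ⟧ · ⟦ c S ⟧ · f S)     ≡⟨ ∑-allSubsets-pick S₀ _ ⟩
    ⟦ c S₀ ⟧ · f S₀                                              ∎
    where open ≡-Reasoning

  ∑-rects-pick : ∀ {nx ny} (Q : Rect nx ny) (f : Rect nx ny → Carrier) →
                 ∑ (rects nx ny) (λ R → ⟦ eqRᵇ R Q ⟧ · f R) ≡ ⟦ nonemptyRᵇ Q ⟧ · f Q
  ∑-rects-pick {nx} {ny} (X₀ , Y₀) f = begin
    ∑ (rects nx ny) (λ R → ⟦ eqRᵇ R (X₀ , Y₀) ⟧ · f R)
      ≡⟨ ∑-concatMap (λ X → map (X ,_) (filterᵇ nonemptyᵇ (allSubsets ny))) (filterᵇ nonemptyᵇ (allSubsets nx)) _ ⟩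
    ∑ (filterᵇ nonemptyᵇ (allSubsets nx)) (λ X → ∑ (map (X ,_) (filterᵇ nonemptyᵇ (allSubsets ny))) _)
      ≡⟨ ∑-cong′ (filterᵇ nonemptyᵇ (allSubsets nx)) (λ X → ∑-map (X ,_) (filterᵇ nonemptyᵇ (allSubsets ny)) _) ⟩
    ∑ (filterᵇ nonemptyᵇ (allSubsets nx)) (λ X → ∑ (filterᵇ nonemptyᵇ (allSubsets ny)) (λ Y → ⟦ eqSᵇ X X₀ ∧ eqSᵇ Y Y₀ ⟧ · f (X , Y)))
      ≡⟨ ∑-cong′ (filterᵇ nonemptyᵇ (allSubsets nx)) (λ X →
           trans (∑-cong′ (filterᵇ nonemptyᵇ (allSubsets ny)) (λ Y → ⟦∧⟧-· (eqSᵇ X X₀) (eqSᵇ Y Y₀) _))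
                 (sym (·-∑ ⟦ eqSᵇ X X₀ ⟧ (filterᵇ nonemptyᵇ (allSubsets ny)) _))) ⟩
    ∑ (filterᵇ nonemptyᵇ (allSubsets nx)) (λ X → ⟦ eqSᵇ X X₀ ⟧ · ∑ (filterᵇ nonemptyᵇ (allSubsets ny)) (λ Y → ⟦ eqSᵇ Y Y₀ ⟧ · f (X , Y)))
      ≡⟨ ∑-filter-allSubsets-pick nonemptyᵇ X₀ _ ⟩
    ⟦ nonemptyᵇ X₀ ⟧ · ∑ (filterᵇ nonemptyᵇ (allSubsets ny)) (λ Y → ⟦ eqSᵇ Y Y₀ ⟧ · f (X₀ , Y))
      ≡⟨ cong (⟦ nonemptyᵇ X₀ ⟧ ·_) (∑-filter-allSubsets-pick nonemptyᵇ Y₀ _) ⟩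
    ⟦ nonemptyᵇ X₀ ⟧ · ⟦ nonemptyᵇ Y₀ ⟧ · f (X₀ , Y₀)
      ≡⟨ sym (⟦∧⟧-· (nonemptyᵇ X₀) _ _) ⟩
    ⟦ nonemptyRᵇ (X₀ , Y₀) ⟧ · f (X₀ , Y₀) ∎
    where open ≡-Reasoning

  ∑-map-filter-pick : ∀ {n} {B : Set} (c : Subset n → Bool) (g : Subset n → B) (eqᵇ : B → B → Bool) (k : B → Carrier) S₀ →
    (∀ S → eqᵇ (g S) (g S₀) ≡ eqSᵇ S S₀) → c S₀ ≡ true →
    ∑ (map g (filterᵇ c (allSubsets n))) (λ P → ⟦ eqᵇ P (g S₀) ⟧ · k P) ≡ k (g S₀)
  ∑-map-filter-pick {n} c g eqᵇ k S₀ eqᵇ-g cS₀ = begin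
    ∑ (map g (filterᵇ c (allSubsets n))) (λ P → ⟦ eqᵇ P (g S₀) ⟧ · k P)  ≡⟨ ∑-map g (filterᵇ c (allSubsets n)) _ ⟩
    ∑ (filterᵇ c (allSubsets n)) (λ S → ⟦ eqᵇ (g S) (g S₀) ⟧ · k (g S))
      ≡⟨ ∑-cong′ (filterᵇ c (allSubsets n)) (λ S → cong (λ b → ⟦ b ⟧ · k (g S)) (eqᵇ-g S)) ⟩
    ∑ (filterᵇ c (allSubsets n)) (λ S → ⟦ eqSᵇ S S₀ ⟧ · k (g S))          ≡⟨ ∑-filter-allSubsets-pick c S₀ _ ⟩
    ⟦ c S₀ ⟧ · k (g S₀)                                                    ≡⟨ cong (λ b → ⟦ b ⟧ · k (g S₀)) cS₀ ⟩
    1 · k (g S₀)                                                           ≡⟨ ×-homo-1 _ ⟩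
    k (g S₀)                                                               ∎
    where open ≡-Reasoning

  ∑-map-none : ∀ {A B : Set} (g : A → B) (l : List A) (p : B → Bool) (k : B → Carrier) →
               (∀ a → p (g a) ≡ false) → ∑ (map g l) (λ b → ⟦ p b ⟧ · k b) ≡ ε
  ∑-map-none g l p k none = trans (∑-map g l _) (trans (∑-cong′ l (λ a → cong (λ b → ⟦ b ⟧ · k (g a)) (none a))) (∑-zero l))

  ∑-parts-pick : ∀ {nx ny} (V : Rect nx ny) (P₀ : Rect nx ny × Rect nx ny) (k : Rect nx ny × Rect nx ny → Carrier) →
                 P₀ ∈ parts V → ∑ (parts V) (λ P → ⟦ eqPᵇ P P₀ ⟧ · k P) ≡ k P₀
  ∑-parts-pick {nx} {ny} (X , Y) P₀ k P₀∈ with ∈-++⁻ (rowParts (X , Y)) P₀∈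
  ... | inj₁ P₀∈row with ∈-map⁻ (rowSplit X Y) P₀∈row
  ...   | S₀ , S₀∈ , refl = trans (∑-++ (rowParts (X , Y)) _ _) (trans (cong₂ _⊕_
           (∑-map-filter-pick (splitsᵇ X) (rowSplit X Y) eqPᵇ k S₀ (λ S → eqPᵇ-rowSplit X Y S S₀) cS₀)
           (∑-map-none (colSplit X Y) (filterᵇ (splitsᵇ Y) (allSubsets ny)) (λ P → eqPᵇ P (rowSplit X Y S₀)) k
                       (λ S → eqPᵇ-col-row X Y S S₀ cS₀)))
           (⊕-identityʳ _))
    where cS₀ = proj₂ (∈-filterᵇ⁻ (splitsᵇ X) (allSubsets nx) S₀∈)
  ∑-parts-pick {nx} {ny} (X , Y) P₀ k P₀∈ | inj₂ P₀∈col with ∈-map⁻ (colSplit X Y) P₀∈col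
  ...   | S₀ , S₀∈ , refl = trans (∑-++ (rowParts (X , Y)) _ _) (trans (cong₂ _⊕_
           (∑-map-none (rowSplit X Y) (filterᵇ (splitsᵇ X) (allSubsets nx)) (λ P → eqPᵇ P (colSplit X Y S₀)) k
                       (λ S → eqPᵇ-row-col X Y S S₀ cS₀))
           (∑-map-filter-pick (splitsᵇ Y) (colSplit X Y) eqPᵇ k S₀ (λ S → eqPᵇ-colSplit X Y S S₀) cS₀))
           (⊕-identityˡ _))
    where cS₀ = proj₂ (∈-filterᵇ⁻ (splitsᵇ Y) (allSubsets ny) S₀∈)

  ∑-Γ : ∀ {nx ny} (h : Branch nx ny → Carrier) →
        ∑ (Γ nx ny) h ≡ ∑ (rects nx ny) (λ V → ∑ (parts V) (λ P → h (V , P)))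
  ∑-Γ {nx} {ny} h = trans (∑-concatMap (λ R → map (R ,_) (parts R)) (rects nx ny) h)
                          (∑-cong′ (rects nx ny) (λ V → ∑-map (V ,_) (parts V) h))

  ∑-Γ-pick : ∀ {nx ny} (V₀ : Rect nx ny) (P₀ : Rect nx ny × Rect nx ny) (h : Branch nx ny → Carrier) →
             nonemptyRᵇ V₀ ≡ true → P₀ ∈ parts V₀ →
             ∑ (Γ nx ny) (λ g → ⟦ eqΓᵇ g (V₀ , P₀) ⟧ · h g) ≡ h (V₀ , P₀)
  ∑-Γ-pick {nx} {ny} V₀ P₀ h neV₀ P₀∈ = begin
    ∑ (Γ nx ny) (λ g → ⟦ eqΓᵇ g (V₀ , P₀) ⟧ · h g)                 ≡⟨ ∑-Γ (λ g → ⟦ eqΓᵇ g (V₀ , P₀) ⟧ · h g) ⟩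
    ∑ (rects nx ny) (λ V → ∑ (parts V) (λ P → ⟦ eqRᵇ V V₀ ∧ eqPᵇ P P₀ ⟧ · h (V , P)))
      ≡⟨ ∑-cong′ (rects nx ny) (λ V → trans (∑-cong′ (parts V) (λ P → ⟦∧⟧-· (eqRᵇ V V₀) _ _))
                                            (sym (·-∑ ⟦ eqRᵇ V V₀ ⟧ (parts V) _))) ⟩
    ∑ (rects nx ny) (λ V → ⟦ eqRᵇ V V₀ ⟧ · ∑ (parts V) (λ P → ⟦ eqPᵇ P P₀ ⟧ · h (V , P)))  ≡⟨ ∑-rects-pick V₀ _ ⟩
    ⟦ nonemptyRᵇ V₀ ⟧ · ∑ (parts V₀) (λ P → ⟦ eqPᵇ P P₀ ⟧ · h (V₀ , P))
      ≡⟨ cong (λ b → ⟦ b ⟧ · ∑ (parts V₀) (λ P → ⟦ eqPᵇ P P₀ ⟧ · h (V₀ , P))) neV₀ ⟩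
    1 · ∑ (parts V₀) (λ P → ⟦ eqPᵇ P P₀ ⟧ · h (V₀ , P))                       ≡⟨ ×-homo-1 _ ⟩
    ∑ (parts V₀) (λ P → ⟦ eqPᵇ P P₀ ⟧ · h (V₀ , P))                           ≡⟨ ∑-parts-pick V₀ P₀ (λ P → h (V₀ , P)) P₀∈ ⟩
    h (V₀ , P₀)                                                              ∎
    where open ≡-Reasoning

-- Protocol trees with the fewest leaves

size : ∀ {nx ny} {R : Rect nx ny} → Tree R → ℕ
size t = length (leaves t)

size-node : ∀ {nx ny} {R A B : Rect nx ny} (p : (A , B) ∈ parts R) (l : Tree A) (r : Tree B) →
            size (node p l r) ≡ size l ℕ.+ size r
size-node p l r = length-++ (leaves l)

size>0 : ∀ {nx ny} {R : Rect nx ny} (t : Tree R) → 0 < size t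
size>0 (leaf R) = s≤s z≤n
size>0 (node p l r) = subst (0 <_) (sym (size-node p l r)) (ℕP.<-≤-trans (size>0 l) (ℕP.m≤m+n _ _))

leaves-nonempty : ∀ {nx ny} {R : Rect nx ny} (t : Tree R) → nonemptyRᵇ R ≡ true →
                  All (λ L → nonemptyRᵇ L ≡ true) (leaves t)
leaves-nonempty (leaf R) ne = ne ∷ []
leaves-nonempty (node {R} {A} {B} p l r) ne =
  All.++⁺ (leaves-nonempty l (Splits.nonemptyˡ V↦AB ne)) (leaves-nonempty r (Splits.nonemptyʳ V↦AB ne))
  where V↦AB = parts⇒Splits R A B p

MonoLeaves : ∀ {nx ny nz} → Rel3 nx ny nz → {R : Rect nx ny} → Tree R → Set
MonoLeaves T t = All (λ L → mono T L ≡ true) (leaves t)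

any-true : {A : Set} (p : A → Bool) {x : A} (l : List A) → x ∈ l → p x ≡ true → any p l ≡ true
any-true p (y ∷ l) (here refl) px rewrite px = refl
any-true p (y ∷ l) (there x∈l) px rewrite any-true p l x∈l px = ∨-zeroʳ (p y)

all-true : {A : Set} (p : A → Bool) (l : List A) → (∀ x → p x ≡ true) → all p l ≡ true
all-true p [] h = refl
all-true p (y ∷ l) h rewrite h y = all-true p l h

firstOf : ∀ {n} → Subset n → Subset n
firstOf [] = []
firstOf (true ∷ xs) = true ∷ replicate _ false
firstOf (false ∷ xs) = false ∷ firstOf xs

firstOf-⊆ : ∀ {n} (X : Subset n) → subᵇ (firstOf X) X ≡ true
firstOf-⊆ [] = refl
firstOf-⊆ (true ∷ xs) = empty-⊆ xs
  where
  empty-⊆ : ∀ {n} (xs : Subset n) → subᵇ (replicate n false) xs ≡ true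
  empty-⊆ [] = refl
  empty-⊆ (x ∷ xs) = empty-⊆ xs
firstOf-⊆ (false ∷ xs) = firstOf-⊆ xs

firstOf-nonempty : ∀ {n} (X : Subset n) → nonemptyᵇ X ≡ true → nonemptyᵇ (firstOf X) ≡ true
firstOf-nonempty (true ∷ xs) e = refl
firstOf-nonempty (false ∷ xs) e = firstOf-nonempty xs e

firstIn-firstOf : ∀ {n} (X : Subset n) → nonemptyᵇ X ≡ true → firstIn X (firstOf X) ≡ true
firstIn-firstOf (true ∷ xs) e = refl
firstIn-firstOf (false ∷ xs) e = firstIn-firstOf xs e

firstOf-unique : ∀ {n} (X : Subset n) i i′ → lookup (firstOf X) i ≡ true → lookup (firstOf X) i′ ≡ true → i ≡ i′
firstOf-unique (true ∷ xs) fzero fzero e e′ = refl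
firstOf-unique (true ∷ xs) fzero (fsuc i′) e e′ = ⊥-elim (true≢false (trans (sym e′) (lookup-replicate i′ false)))
firstOf-unique (true ∷ xs) (fsuc i) i′ e e′ = ⊥-elim (true≢false (trans (sym e) (lookup-replicate i false)))
firstOf-unique (false ∷ xs) (fsuc i) (fsuc i′) e e′ = cong fsuc (firstOf-unique xs i i′ e e′)

splitsᵇ-firstOf : ∀ {n} (X : Subset n) → nonemptyᵇ X ≡ true → nonemptyᵇ (X ∩ ∁ (firstOf X)) ≡ true →
                  splitsᵇ X (firstOf X) ≡ true
splitsᵇ-firstOf X neX neR rewrite firstOf-⊆ X | firstOf-nonempty X neX | neR | firstIn-firstOf X neX = refl

singleton-if-rest-empty : ∀ {n} (X : Subset n) → nonemptyᵇ (X ∩ ∁ (firstOf X)) ≡ false →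
                          ∀ i i′ → lookup X i ≡ true → lookup X i′ ≡ true → i ≡ i′
singleton-if-rest-empty X rest-empty i i′ X∋i X∋i′ = firstOf-unique X i i′ (first∋ i X∋i) (first∋ i′ X∋i′)
  where
  first∋ : ∀ i → lookup X i ≡ true → lookup (firstOf X) i ≡ true
  first∋ i X∋i with lookup (firstOf X) i in e
  ... | true = refl
  ... | false = ⊥-elim (true≢false (trans (sym (∃⇒nonemptyᵇ (X ∩ ∁ (firstOf X)) i
                  (trans (lookup-∩∁ X (firstOf X) i) (cong₂ (λ a b → a ∧ not b) X∋i e)))) rest-empty))

cheapest : ∀ {nx ny} {R : Rect nx ny} → Tree R → List (Tree R) → Tree R
cheapest d [] = d
cheapest d (t ∷ ts) = argmin size t ts

cheapest-≤ : ∀ {nx ny} {R : Rect nx ny} (d : Tree R) {ts : List (Tree R)} {v : ℕ} →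
             Any (λ t → size t ≤ v) ts → size (cheapest d ts) ≤ v
cheapest-≤ d {t ∷ ts} (here t≤v) = f[argmin]≤v⁺ {f = size} t ts (inj₁ t≤v)
cheapest-≤ d {t ∷ ts} (there ts≤v) = f[argmin]≤v⁺ {f = size} t ts (inj₂ ts≤v)

cheapest-all : ∀ {nx ny} {R : Rect nx ny} {P : Tree R → Set} (d : Tree R) {ts : List (Tree R)} →
               ts ≢ [] → All P ts → P (cheapest d ts)
cheapest-all d {[]} ts≢[] [] = ⊥-elim (ts≢[] refl)
cheapest-all d {t ∷ ts} _ (Pt ∷ Pts) = argmin-all size Pt Pts

Total : ∀ {nx ny nz} → Rel3 nx ny nz → Set
Total {nx} {ny} {nz} T = ∀ (x : Fin nx) (y : Fin ny) → ∃ λ (z : Fin nz) → T x y z ≡ true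

∥∥>0 : ∀ {nx ny} (R : Rect nx ny) → nonemptyRᵇ R ≡ true → 0 < ∥ R ∥
∥∥>0 (X , Y) ne = ℕP.<-≤-trans (card-nonempty X (proj₁ (∧-≡true⁻ {nonemptyᵇ X} ne))) (ℕP.m≤m+n (card X) (card Y))

module OptimalTrees {nx ny nz : ℕ} (T : Rel3 nx ny nz) where

  single-cell-mono : Total T → ∀ X Y → nonemptyRᵇ (X , Y) ≡ true →
                     nonemptyᵇ (X ∩ ∁ (firstOf X)) ≡ false → nonemptyᵇ (Y ∩ ∁ (firstOf Y)) ≡ false →
                     mono T (X , Y) ≡ true
  single-cell-mono total X Y ne restX restY =
    any-true _ (allFin nz) (∈-allFin z₀) (all-true _ (allFin nx) (λ i → all-true _ (allFin ny) (λ j → z₀-on i j)))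
    where
    i₀,X∋i₀ = nonemptyᵇ⇒∃ X (proj₁ (∧-≡true⁻ {nonemptyᵇ X} ne))
    j₀,Y∋j₀ = nonemptyᵇ⇒∃ Y (proj₂ (∧-≡true⁻ {nonemptyᵇ X} ne))
    i₀ = proj₁ i₀,X∋i₀
    j₀ = proj₁ j₀,Y∋j₀
    X∋i₀ = proj₂ i₀,X∋i₀
    Y∋j₀ = proj₂ j₀,Y∋j₀
    z₀ = proj₁ (total i₀ j₀)
    z₀-on : ∀ i j → not (cellIn i j (X , Y)) ∨ T i j z₀ ≡ true
    z₀-on i j with lookup X i in X∋i | lookup Y j in Y∋j
    ... | true | true rewrite singleton-if-rest-empty X restX i i₀ X∋i X∋i₀
                            | singleton-if-rest-empty Y restY j j₀ Y∋j Y∋j₀ = proj₂ (total i₀ j₀)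
    ... | true | false = refl
    ... | false | _ = refl

  splittable : Total T → (R : Rect nx ny) → nonemptyRᵇ R ≡ true → mono T R ≡ false →
               ∃ λ AB → AB ∈ parts R
  splittable total (X , Y) ne nm
    with ∧-≡true⁻ {nonemptyᵇ X} ne | nonemptyᵇ (X ∩ ∁ (firstOf X)) in restX | nonemptyᵇ (Y ∩ ∁ (firstOf Y)) in restY
  ... | neX , _ | true | _ =
    rowSplit X Y (firstOf X) ,
    ∈-++⁺ˡ (∈-map⁺ (rowSplit X Y) (∈-filterᵇ⁺ (splitsᵇ X) (∈-allSubsets _) (splitsᵇ-firstOf X neX restX)))
  ... | _ , neY | false | true =
    colSplit X Y (firstOf Y) ,
    ∈-++⁺ʳ (rowParts (X , Y)) (∈-map⁺ (colSplit X Y) (∈-filterᵇ⁺ (splitsᵇ Y) (∈-allSubsets _) (splitsᵇ-firstOf Y neY restY)))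
  ... | _ | false | false = ⊥-elim (true≢false (trans (sym (single-cell-mono total X Y ne restX restY)) nm))

  splitTrees : ((Q : Rect nx ny) → Tree Q) → (R : Rect nx ny) → List (Tree R)
  splitTrees opt R = mapWith∈ (parts R) (λ {AB} AB∈ → node AB∈ (opt (proj₁ AB)) (opt (proj₂ AB)))

  -- Fuel ∥ R ∥ suffices, as the parts of a partition are smaller; with it a nonempty R that is
  -- not monochromatic never falls back to leaf R.
  optTree : ℕ → (R : Rect nx ny) → Tree R
  optTree zero R = leaf R
  optTree (suc n) R = if mono T R then leaf R else cheapest (leaf R) (splitTrees (optTree n) R)

  splitTrees-≤ : ∀ opt {R A B} (AB∈ : (A , B) ∈ parts R) →
                 size (cheapest (leaf R) (splitTrees opt R)) ≤ size (opt A) ℕ.+ size (opt B)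
  splitTrees-≤ opt {A = A} {B} AB∈ =
    cheapest-≤ _ (mapWith∈⁺ _ ((A , B) , AB∈ , ℕP.≤-reflexive (size-node AB∈ (opt A) (opt B))))

  splitTrees-≢[] : ∀ opt {R AB} → AB ∈ parts R → splitTrees opt R ≢ []
  splitTrees-≢[] opt {AB = AB} AB∈ ts≡[] = ¬Any[] (subst (Any (λ _ → 𝟙)) ts≡[] (mapWith∈⁺ _ (AB , AB∈ , tt)))

  splitTrees-all : ∀ opt {R} {P : Tree R → Set} →
                   (∀ {A B} (AB∈ : (A , B) ∈ parts R) → P (node AB∈ (opt A) (opt B))) → All P (splitTrees opt R)
  splitTrees-all opt {R} {P} P-node = All-tabulate λ t∈ → P-member (mapWith∈⁻ (parts R) _ t∈)
    where
    P-member : ∀ {t} → ∃ (λ AB → Σ (AB ∈ parts R) λ AB∈ → t ≡ node AB∈ (opt (proj₁ AB)) (opt (proj₂ AB))) → P t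
    P-member (AB , AB∈ , refl) = P-node AB∈

  optTree-≤ : ∀ n {R} (t : Tree R) → ∥ R ∥ ≤ n → MonoLeaves T t → size (optTree n R) ≤ size t
  optTree-≤ zero (leaf R) _ _ = ℕP.≤-refl
  optTree-≤ zero (node {R} {A} {B} AB∈ l r) R≤0 _ =
    ⊥-elim (ℕP.n≮0 (ℕP.<-≤-trans (Splits.smallerˡ (parts⇒Splits R A B AB∈)) R≤0))
  optTree-≤ (suc n) (leaf R) _ (monoR ∷ []) rewrite monoR = ℕP.≤-refl
  optTree-≤ (suc n) (node {R} {A} {B} AB∈ l r) R≤ monoLeaves with mono T R
  ... | true = size>0 (node AB∈ l r)
  ... | false = ℕP.≤-trans (splitTrees-≤ (optTree n) AB∈)
                  (subst (_ ≤_) (sym (size-node AB∈ l r))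
                    (ℕP.+-mono-≤ (optTree-≤ n l (smaller A (Splits.smallerˡ R↦AB)) (All.++⁻ˡ (leaves l) monoLeaves))
                                 (optTree-≤ n r (smaller B (Splits.smallerʳ R↦AB)) (All.++⁻ʳ (leaves l) monoLeaves))))
    where
    R↦AB = parts⇒Splits R A B AB∈
    smaller : ∀ Q → ∥ Q ∥ < ∥ R ∥ → ∥ Q ∥ ≤ n
    smaller Q Q<R = ℕP.≤-pred (ℕP.<-≤-trans Q<R R≤)

  optTree-monoLeaves : Total T → ∀ n R → nonemptyRᵇ R ≡ true → ∥ R ∥ ≤ n → MonoLeaves T (optTree n R)
  optTree-monoLeaves total zero R ne R≤0 = ⊥-elim (ℕP.n≮0 (ℕP.<-≤-trans (∥∥>0 R ne) R≤0))
  optTree-monoLeaves total (suc n) R ne R≤ with mono T R in monoR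
  ... | true = monoR ∷ []
  ... | false = cheapest-all {P = MonoLeaves T} (leaf R) (splitTrees-≢[] (optTree n) (proj₂ (splittable total R ne monoR)))
                  (splitTrees-all (optTree n) children)
    where
    child : ∀ Q → nonemptyRᵇ Q ≡ true → ∥ Q ∥ < ∥ R ∥ → MonoLeaves T (optTree n Q)
    child Q neQ Q<R = optTree-monoLeaves total n Q neQ (ℕP.≤-pred (ℕP.<-≤-trans Q<R R≤))
    children : ∀ {A B} (AB∈ : (A , B) ∈ parts R) → MonoLeaves T (node AB∈ (optTree n A) (optTree n B))
    children {A} {B} AB∈ = All.++⁺ (child A (Splits.nonemptyˡ R↦AB ne) (Splits.smallerˡ R↦AB))
                                   (child B (Splits.nonemptyʳ R↦AB ne) (Splits.smallerʳ R↦AB))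
      where R↦AB = parts⇒Splits R A B AB∈

  minTree : (R : Rect nx ny) → Tree R
  minTree R = optTree ∥ R ∥ R

  minLeaves : Rect nx ny → ℕ
  minLeaves R = size (minTree R)

  minLeaves-≤ : ∀ {R} (t : Tree R) → MonoLeaves T t → minLeaves R ≤ size t
  minLeaves-≤ {R} t = optTree-≤ ∥ R ∥ t ℕP.≤-refl

  minTree-monoLeaves : Total T → ∀ R → nonemptyRᵇ R ≡ true → MonoLeaves T (minTree R)
  minTree-monoLeaves total R ne = optTree-monoLeaves total ∥ R ∥ R ne ℕP.≤-refl

  minLeaves-mono : ∀ R → mono T R ≡ true → minLeaves R ≡ 1
  minLeaves-mono R monoR with ∥ R ∥
  ... | zero = refl
  ... | suc n rewrite monoR = refl

  minLeaves-subadditive : Total T → ∀ {V A B} → nonemptyRᵇ V ≡ true → (A , B) ∈ parts V →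
                          minLeaves V ≤ minLeaves A ℕ.+ minLeaves B
  minLeaves-subadditive total {V} {A} {B} ne AB∈ =
    subst (minLeaves V ≤_) (size-node AB∈ (minTree A) (minTree B))
      (minLeaves-≤ (node AB∈ (minTree A) (minTree B))
        (All.++⁺ (minTree-monoLeaves total A (Splits.nonemptyˡ V↦AB ne))
                 (minTree-monoLeaves total B (Splits.nonemptyʳ V↦AB ne))))
    where V↦AB = parts⇒Splits V A B AB∈

internals : ∀ {nx ny} {R : Rect nx ny} → Tree R → List (Branch nx ny)
internals (leaf R) = []
internals (node {R} {A} {B} p l r) = (R , (A , B)) ∷ (internals l ++ internals r)

internals-isBranch : ∀ {nx ny} {R : Rect nx ny} (t : Tree R) → nonemptyRᵇ R ≡ true → All IsBranch (internals t)
internals-isBranch (leaf R) ne = []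
internals-isBranch (node {R} {A} {B} p l r) ne =
  (ne , p) ∷ All.++⁺ (internals-isBranch l (Splits.nonemptyˡ R↦AB ne)) (internals-isBranch r (Splits.nonemptyʳ R↦AB ne))
  where R↦AB = parts⇒Splits R A B p

⟦∨⟧-disjoint : ∀ a b → a ∧ b ≡ false → ⟦ a ∨ b ⟧ ≡ ⟦ a ⟧ ℕ.+ ⟦ b ⟧
⟦∨⟧-disjoint true false _ = refl
⟦∨⟧-disjoint false b _ = refl

⟦cellIn⟧-split : ∀ {nx ny} {V A B : Rect nx ny} → Splits V A B → ∀ i j →
                 ⟦ cellIn i j V ⟧ ≡ ⟦ cellIn i j A ⟧ ℕ.+ ⟦ cellIn i j B ⟧
⟦cellIn⟧-split {A = A} {B} V↦AB i j =
  trans (cong ⟦_⟧ (Splits.covers V↦AB i j)) (⟦∨⟧-disjoint (cellIn i j A) (cellIn i j B) (Splits.disjoint V↦AB i j))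

⟦inPartᵇ⟧ : ∀ {nx ny} (R : Rect nx ny) {A B : Rect nx ny} → A ≢ B →
            ⟦ inPartᵇ R (A , B) ⟧ ≡ ⟦ eqRᵇ A R ⟧ ℕ.+ ⟦ eqRᵇ B R ⟧
⟦inPartᵇ⟧ R {A} {B} A≢B rewrite eqRᵇ-sym A R | eqRᵇ-sym B R with eqRᵇ R A in RA | eqRᵇ R B in RB
... | true | true = ⊥-elim (A≢B (trans (sym (eqRᵇ⇒≡ R A RA)) (eqRᵇ⇒≡ R B RB)))
... | true | false = refl
... | false | _ = refl

module Counting where
  open Sums ℕ-monoid
  open Picking ℕ-monoid
  open +-*-Solver using (solve; _:+_; _:=_)

  ·≡* : ∀ m n → m · n ≡ m ℕ.* n
  ·≡* zero n = refl
  ·≡* (suc m) n = cong (n ℕ.+_) (·≡* m n)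

  ∑-const-1 : {B : Set} (l : List B) → ∑ l (λ _ → 1) ≡ length l
  ∑-const-1 [] = refl
  ∑-const-1 (b ∷ l) = cong suc (∑-const-1 l)

  ∑-eqRᵇ : ∀ {nx ny} (V : Rect nx ny) (f : Rect nx ny → ℕ) → nonemptyRᵇ V ≡ true →
           ∑ (rects nx ny) (λ R → f R ℕ.* ⟦ eqRᵇ V R ⟧) ≡ f V
  ∑-eqRᵇ {nx} {ny} V f neV = begin
    ∑ (rects nx ny) (λ R → f R ℕ.* ⟦ eqRᵇ V R ⟧)   ≡⟨ ∑-cong′ (rects nx ny) swap ⟩
    ∑ (rects nx ny) (λ R → ⟦ eqRᵇ R V ⟧ · f R)     ≡⟨ ∑-rects-pick V f ⟩
    ⟦ nonemptyRᵇ V ⟧ · f V                         ≡⟨ cong (λ b → ⟦ b ⟧ · f V) neV ⟩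
    1 · f V                                        ≡⟨ ×-homo-1 (f V) ⟩
    f V                                            ∎
    where
    open ≡-Reasoning
    swap : ∀ R → f R ℕ.* ⟦ eqRᵇ V R ⟧ ≡ ⟦ eqRᵇ R V ⟧ · f R
    swap R rewrite ·≡* ⟦ eqRᵇ R V ⟧ (f R) | eqRᵇ-sym R V = ℕP.*-comm (f R) _

  proper : ∀ {nx ny} → Rect nx ny → ℕ
  proper R = ⟦ not (eqRᵇ R fullR) ⟧

  proper≡1 : ∀ {nx ny} (R : Rect nx ny) → R ≢ fullR → proper R ≡ 1
  proper≡1 R R≢full rewrite ≢⇒eqRᵇ≡false R fullR R≢full = refl

  ∑-proper-inPart : ∀ {nx ny} {V A B : Rect nx ny} (f : Rect nx ny → ℕ) → nonemptyRᵇ V ≡ true → (A , B) ∈ parts V →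
    ∑ (rects nx ny) (λ R → (proper R ℕ.* f R) ℕ.* ⟦ inPartᵇ R (A , B) ⟧) ≡ f A ℕ.+ f B
  ∑-proper-inPart {nx} {ny} {V} {A} {B} f neV AB∈ = begin
    ∑ (rects nx ny) (λ R → c R ℕ.* ⟦ inPartᵇ R (A , B) ⟧)
      ≡⟨ ∑-cong′ (rects nx ny) (λ R → trans (cong (c R ℕ.*_) (⟦inPartᵇ⟧ R (Splits.distinct V↦AB))) (ℕP.*-distribˡ-+ (c R) _ _)) ⟩
    ∑ (rects nx ny) (λ R → c R ℕ.* ⟦ eqRᵇ A R ⟧ ℕ.+ c R ℕ.* ⟦ eqRᵇ B R ⟧)   ≡⟨ ∑-⊕ (rects nx ny) _ _ ⟩
    ∑ (rects nx ny) (λ R → c R ℕ.* ⟦ eqRᵇ A R ⟧) ℕ.+ ∑ (rects nx ny) (λ R → c R ℕ.* ⟦ eqRᵇ B R ⟧)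
      ≡⟨ cong₂ ℕ._+_ (∑-eqRᵇ A c (Splits.nonemptyˡ V↦AB neV)) (∑-eqRᵇ B c (Splits.nonemptyʳ V↦AB neV)) ⟩
    c A ℕ.+ c B
      ≡⟨ cong₂ ℕ._+_ (trans (cong (ℕ._* f A) (proper≡1 A (Splits.≢fullˡ V↦AB))) (ℕP.*-identityˡ (f A)))
                     (trans (cong (ℕ._* f B) (proper≡1 B (Splits.≢fullʳ V↦AB))) (ℕP.*-identityˡ (f B))) ⟩
    f A ℕ.+ f B                                                              ∎
    where
    open ≡-Reasoning
    V↦AB = parts⇒Splits V A B AB∈
    c : Rect nx ny → ℕ
    c R = proper R ℕ.* f R

  ∑-member-≤ : {B : Set} (f : B → ℕ) {b : B} {l : List B} → b ∈ l → f b ≤ ∑ l f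
  ∑-member-≤ f {l = b ∷ l} (here refl) = ℕP.m≤m+n (f b) _
  ∑-member-≤ f {l = b′ ∷ l} (there b∈l) = ℕP.≤-trans (∑-member-≤ f b∈l) (ℕP.m≤n+m _ (f b′))

  count≡1⇒any : {B : Set} (p : B → Bool) (l : List B) → ∑ l (λ b → ⟦ p b ⟧) ≡ 1 → Any (λ b → p b ≡ true) l
  count≡1⇒any p (b ∷ l) count≡1 with p b in pb
  ... | true = here pb
  ... | false = there (count≡1⇒any p l count≡1)

  count≤1⇒disjoint : ∀ {nx ny} (l : List (Rect nx ny)) → (∀ i j → ∑ l (λ L → ⟦ cellIn i j L ⟧) ≤ 1) → AllPairs Disjoint l
  count≤1⇒disjoint [] _ = []
  count≤1⇒disjoint (L ∷ l) count≤1 =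
    All-tabulate (λ L′∈ → not-both L′∈) ∷ count≤1⇒disjoint l (λ i j → ℕP.≤-trans (ℕP.m≤n+m _ _) (count≤1 i j))
    where
    not-both : ∀ {L′} → L′ ∈ l → ∀ i j → cellIn i j L ≡ true → cellIn i j L′ ≡ false
    not-both {L′} L′∈ i j L∋ with cellIn i j L′ in L′∋
    ... | false = refl
    ... | true = ⊥-elim (ℕP.<⇒≱ (s≤s (subst (_≤ ∑ l (λ L″ → ⟦ cellIn i j L″ ⟧)) (cong ⟦_⟧ L′∋) (∑-member-≤ _ L′∈)))
                                (subst (λ b → ⟦ b ⟧ ℕ.+ ∑ l (λ L″ → ⟦ cellIn i j L″ ⟧) ≤ 1) L∋ (count≤1 i j)))

  cellIn-count : ∀ {nx ny} {R : Rect nx ny} (t : Tree R) i j →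
                 ∑ (leaves t) (λ L → ⟦ cellIn i j L ⟧) ≡ ⟦ cellIn i j R ⟧
  cellIn-count (leaf R) i j = ℕP.+-identityʳ _
  cellIn-count (node {R} {A} {B} p l r) i j =
    trans (∑-++ (leaves l) (leaves r) _)
          (trans (cong₂ ℕ._+_ (cellIn-count l i j) (cellIn-count r i j))
                 (sym (⟦cellIn⟧-split (parts⇒Splits R A B p) i j)))

  ⟦⟧≤1 : ∀ b → ⟦ b ⟧ ≤ 1
  ⟦⟧≤1 true = ℕP.≤-refl
  ⟦⟧≤1 false = z≤n

  leaves-disjoint : ∀ {nx ny} {R : Rect nx ny} (t : Tree R) → AllPairs Disjoint (leaves t)
  leaves-disjoint {R = R} t = count≤1⇒disjoint (leaves t) (λ i j → subst (_≤ 1) (sym (cellIn-count t i j)) (⟦⟧≤1 (cellIn i j R)))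

  leaves-cover : ∀ {nx ny} (t : Tree (fullR {nx} {ny})) i j → Any (λ L → cellIn i j L ≡ true) (leaves t)
  leaves-cover t i j = count≡1⇒any (cellIn i j) (leaves t) (trans (cellIn-count t i j) (cong ⟦_⟧ (cellIn-full i j)))

  -- Every vertex except the root is a child of exactly one internal vertex, and is itself
  -- either internal or a leaf.
  flow-balance : ∀ {nx ny} {V : Rect nx ny} (t : Tree V) (R : Rect nx ny) →
    ∑ (internals t) (λ g → ⟦ inPartᵇ R (proj₂ g) ⟧) ℕ.+ ⟦ eqRᵇ V R ⟧
    ≡ ∑ (internals t) (λ g → ⟦ eqRᵇ (proj₁ g) R ⟧) ℕ.+ ∑ (leaves t) (λ L → ⟦ eqRᵇ L R ⟧)
  flow-balance (leaf V) R = cong (0 ℕ.+_) (sym (ℕP.+-identityʳ _))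
  flow-balance (node {V} {A} {B} p l r) R = begin
    (⟦ inPartᵇ R (A , B) ⟧ ℕ.+ ∑ (internals l ++ internals r) into) ℕ.+ ⟦ eqRᵇ V R ⟧
      ≡⟨ cong₂ (λ u w → (u ℕ.+ w) ℕ.+ ⟦ eqRᵇ V R ⟧) (⟦inPartᵇ⟧ R (Splits.distinct (parts⇒Splits V A B p)))
                                                 (∑-++ (internals l) (internals r) into) ⟩
    ((⟦ eqRᵇ A R ⟧ ℕ.+ ⟦ eqRᵇ B R ⟧) ℕ.+ (Il ℕ.+ Ir)) ℕ.+ ⟦ eqRᵇ V R ⟧
      ≡⟨ solve 5 (λ a b il ir v → ((a :+ b) :+ (il :+ ir)) :+ v := v :+ ((il :+ a) :+ (ir :+ b))) refl
           ⟦ eqRᵇ A R ⟧ ⟦ eqRᵇ B R ⟧ Il Ir ⟦ eqRᵇ V R ⟧ ⟩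
    ⟦ eqRᵇ V R ⟧ ℕ.+ ((Il ℕ.+ ⟦ eqRᵇ A R ⟧) ℕ.+ (Ir ℕ.+ ⟦ eqRᵇ B R ⟧))
      ≡⟨ cong (⟦ eqRᵇ V R ⟧ ℕ.+_) (cong₂ ℕ._+_ (flow-balance l R) (flow-balance r R)) ⟩
    ⟦ eqRᵇ V R ⟧ ℕ.+ ((Ol ℕ.+ Ll) ℕ.+ (Or ℕ.+ Lr))
      ≡⟨ solve 5 (λ v ol ll or lr → v :+ ((ol :+ ll) :+ (or :+ lr)) := (v :+ (ol :+ or)) :+ (ll :+ lr)) refl
           ⟦ eqRᵇ V R ⟧ Ol Ll Or Lr ⟩
    (⟦ eqRᵇ V R ⟧ ℕ.+ (Ol ℕ.+ Or)) ℕ.+ (Ll ℕ.+ Lr)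
      ≡⟨ sym (cong₂ (λ u w → (⟦ eqRᵇ V R ⟧ ℕ.+ u) ℕ.+ w) (∑-++ (internals l) (internals r) out) (∑-++ (leaves l) (leaves r) is)) ⟩
    (⟦ eqRᵇ V R ⟧ ℕ.+ ∑ (internals l ++ internals r) out) ℕ.+ ∑ (leaves l ++ leaves r) is ∎
    where
    open ≡-Reasoning
    into out : Branch _ _ → ℕ
    into g = ⟦ inPartᵇ R (proj₂ g) ⟧
    out g = ⟦ eqRᵇ (proj₁ g) R ⟧
    is : Rect _ _ → ℕ
    is L = ⟦ eqRᵇ L R ⟧
    Il = ∑ (internals l) into
    Ir = ∑ (internals r) into
    Ol = ∑ (internals l) out
    Or = ∑ (internals r) out
    Ll = ∑ (leaves l) is
    Lr = ∑ (leaves r) is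

-- The integral solution of a protocol tree

module TreeSolution {nx ny nz : ℕ} (T : Rel3 nx ny nz) (t : Tree (fullR {nx} {ny}))
                    (monoLeaves : MonoLeaves T t) (full-nonempty : nonemptyRᵇ (fullR {nx} {ny}) ≡ true) where
  open Sums ℕ-monoid
  open Picking ℕ-monoid
  open Counting
  open Program ℕ._+_ 0 1 T

  leafCount : Rect nx ny → ℕ
  leafCount R = ∑ (leaves t) (λ L → ⟦ eqRᵇ L R ⟧)

  branchCount : Branch nx ny → ℕ
  branchCount g = ∑ (internals t) (λ g′ → ⟦ eqΓᵇ g′ g ⟧)

  ∑-leafCount : ∀ (w : Rect nx ny → ℕ) → ∑ (rects nx ny) (λ R → w R · leafCount R) ≡ ∑ (leaves t) w
  ∑-leafCount w = begin
    ∑ (rects nx ny) (λ R → w R · leafCount R)                              ≡⟨ ∑-cong′ (rects nx ny) (λ R → ·-∑ (w R) (leaves t) _) ⟩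
    ∑ (rects nx ny) (λ R → ∑ (leaves t) (λ L → w R · ⟦ eqRᵇ L R ⟧))       ≡⟨ ∑-comm (rects nx ny) (leaves t) _ ⟩
    ∑ (leaves t) (λ L → ∑ (rects nx ny) (λ R → w R · ⟦ eqRᵇ L R ⟧))       ≡⟨ ∑-cong′ (leaves t) (λ L → ∑-cong′ (rects nx ny) (swap L)) ⟩
    ∑ (leaves t) (λ L → ∑ (rects nx ny) (λ R → ⟦ eqRᵇ R L ⟧ · w R))       ≡⟨ ∑-cong′ (leaves t) (λ L → ∑-rects-pick L w) ⟩
    ∑ (leaves t) (λ L → ⟦ nonemptyRᵇ L ⟧ · w L)
      ≡⟨ ∑-cong (leaves t) (λ L L∈ → cong (λ b → ⟦ b ⟧ · w L) (All-lookup (leaves-nonempty t full-nonempty) L∈)) ⟩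
    ∑ (leaves t) (λ L → 1 · w L)                                           ≡⟨ ∑-cong′ (leaves t) (λ L → ×-homo-1 (w L)) ⟩
    ∑ (leaves t) w                                                         ∎
    where
    open ≡-Reasoning
    swap : ∀ L R → w R · ⟦ eqRᵇ L R ⟧ ≡ ⟦ eqRᵇ R L ⟧ · w R
    swap L R rewrite ·≡* (w R) ⟦ eqRᵇ L R ⟧ | ·≡* ⟦ eqRᵇ R L ⟧ (w R) | eqRᵇ-sym L R = ℕP.*-comm (w R) _

  ∑-branchCount : ∀ (h : Branch nx ny → ℕ) → ∑ (Γ nx ny) (λ g → h g · branchCount g) ≡ ∑ (internals t) h
  ∑-branchCount h = begin
    ∑ (Γ nx ny) (λ g → h g · branchCount g)                                ≡⟨ ∑-cong′ (Γ nx ny) (λ g → ·-∑ (h g) (internals t) _) ⟩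
    ∑ (Γ nx ny) (λ g → ∑ (internals t) (λ g′ → h g · ⟦ eqΓᵇ g′ g ⟧))      ≡⟨ ∑-comm (Γ nx ny) (internals t) _ ⟩
    ∑ (internals t) (λ g′ → ∑ (Γ nx ny) (λ g → h g · ⟦ eqΓᵇ g′ g ⟧))      ≡⟨ ∑-cong′ (internals t) (λ g′ → ∑-cong′ (Γ nx ny) (swap g′)) ⟩
    ∑ (internals t) (λ g′ → ∑ (Γ nx ny) (λ g → ⟦ eqΓᵇ g g′ ⟧ · h g))
      ≡⟨ ∑-cong (internals t) (λ g′ g′∈ → pick g′ (All-lookup (internals-isBranch t full-nonempty) g′∈)) ⟩
    ∑ (internals t) h                                                      ∎
    where
    open ≡-Reasoning
    swap : ∀ g′ g → h g · ⟦ eqΓᵇ g′ g ⟧ ≡ ⟦ eqΓᵇ g g′ ⟧ · h g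
    swap g′ g rewrite ·≡* (h g) ⟦ eqΓᵇ g′ g ⟧ | ·≡* ⟦ eqΓᵇ g g′ ⟧ (h g) | eqΓᵇ-sym g′ g = ℕP.*-comm (h g) _
    pick : ∀ g′ → IsBranch g′ → ∑ (Γ nx ny) (λ g → ⟦ eqΓᵇ g g′ ⟧ · h g) ≡ h g′
    pick (V , P) (neV , P∈) = ∑-Γ-pick V P h neV P∈

  leafCount-nonmono : ∀ R → mono T R ≡ false → leafCount R ≡ 0
  leafCount-nonmono R nonmono = trans (∑-cong (leaves t) (λ L L∈ → cong ⟦_⟧ (≢⇒eqRᵇ≡false L R (L≢R L∈)))) (∑-zero (leaves t))
    where
    L≢R : ∀ {L} → L ∈ leaves t → L ≢ R
    L≢R L∈ L≡R = true≢false (trans (sym (All-lookup monoLeaves L∈)) (trans (cong (mono T) L≡R) nonmono))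

  covered-once : ∀ i j → sumOver (filterᵇ (cellIn i j) (monoRects T)) leafCount ≡ 1
  covered-once i j = begin
    sumOver (filterᵇ (cellIn i j) (filterᵇ (mono T) (rects nx ny))) leafCount
      ≡⟨ ∑-filterᵇ (cellIn i j) (filterᵇ (mono T) (rects nx ny)) leafCount ⟩
    ∑ (filterᵇ (mono T) (rects nx ny)) (λ R → ⟦ cellIn i j R ⟧ · leafCount R)
      ≡⟨ ∑-filterᵇ (mono T) (rects nx ny) _ ⟩
    ∑ (rects nx ny) (λ R → ⟦ mono T R ⟧ · ⟦ cellIn i j R ⟧ · leafCount R)
      ≡⟨ ∑-cong′ (rects nx ny) (λ R → ×-assocˡ (leafCount R) ⟦ mono T R ⟧ ⟦ cellIn i j R ⟧) ⟩
    ∑ (rects nx ny) (λ R → (⟦ mono T R ⟧ ℕ.* ⟦ cellIn i j R ⟧) · leafCount R)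
      ≡⟨ ∑-leafCount (λ R → ⟦ mono T R ⟧ ℕ.* ⟦ cellIn i j R ⟧) ⟩
    ∑ (leaves t) (λ L → ⟦ mono T L ⟧ ℕ.* ⟦ cellIn i j L ⟧)
      ≡⟨ ∑-cong (leaves t) (λ L L∈ → trans (cong (λ b → ⟦ b ⟧ ℕ.* ⟦ cellIn i j L ⟧) (All-lookup monoLeaves L∈)) (ℕP.*-identityˡ _)) ⟩
    ∑ (leaves t) (λ L → ⟦ cellIn i j L ⟧)                      ≡⟨ cellIn-count t i j ⟩
    ⟦ cellIn i j fullR ⟧                                        ≡⟨ cong ⟦_⟧ (cellIn-full i j) ⟩
    1                                                           ∎
    where open ≡-Reasoning

  into out : Rect nx ny → Branch nx ny → ℕ
  into R g = ⟦ inPartᵇ R (proj₂ g) ⟧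
  out R g = ⟦ eqRᵇ (proj₁ g) R ⟧

  inflow≡ : ∀ R → sumOver (filterᵇ (λ g → inPartᵇ R (proj₂ g)) (Γ nx ny)) branchCount ≡ ∑ (internals t) (into R)
  inflow≡ R = trans (∑-filterᵇ (λ g → inPartᵇ R (proj₂ g)) (Γ nx ny) branchCount) (∑-branchCount (into R))

  outflow≡ : ∀ R → sumOver (filterᵇ (λ g → eqRᵇ (proj₁ g) R) (Γ nx ny)) branchCount ≡ ∑ (internals t) (out R)
  outflow≡ R = trans (∑-filterᵇ (λ g → eqRᵇ (proj₁ g) R) (Γ nx ny) branchCount) (∑-branchCount (out R))

  balance : ∀ R → R ≢ fullR → ∑ (internals t) (into R) ≡ ∑ (internals t) (out R) ℕ.+ leafCount R
  balance R R≢full = begin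
    ∑ (internals t) (into R)                                ≡⟨ sym (ℕP.+-identityʳ _) ⟩
    ∑ (internals t) (into R) ℕ.+ 0
      ≡⟨ cong (λ b → ∑ (internals t) (into R) ℕ.+ ⟦ b ⟧) (sym (≢⇒eqRᵇ≡false fullR R (λ e → R≢full (sym e)))) ⟩
    ∑ (internals t) (into R) ℕ.+ ⟦ eqRᵇ fullR R ⟧          ≡⟨ flow-balance t R ⟩
    ∑ (internals t) (out R) ℕ.+ leafCount R                  ∎
    where open ≡-Reasoning

  flow-conserved : ∀ R → R ∈ rects nx ny → R ≢ fullR →
    sumOver (filterᵇ (λ g → inPartᵇ R (proj₂ g)) (Γ nx ny)) branchCount
    ≡ (if mono T R then sumOver (filterᵇ (λ g → eqRᵇ (proj₁ g) R) (Γ nx ny)) branchCount ℕ.+ leafCount R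
       else sumOver (filterᵇ (λ g → eqRᵇ (proj₁ g) R) (Γ nx ny)) branchCount)
  flow-conserved R _ R≢full with mono T R in monoR
  ... | true = trans (inflow≡ R) (trans (balance R R≢full) (cong (ℕ._+ leafCount R) (sym (outflow≡ R))))
  ... | false = trans (inflow≡ R) (trans (balance R R≢full)
                  (trans (cong (∑ (internals t) (out R) ℕ.+_) (leafCount-nonmono R monoR))
                         (trans (ℕP.+-identityʳ _) (sym (outflow≡ R)))))

  feasible : Feasible leafCount branchCount
  feasible = covered-once , flow-conserved

  objective≡size : objective leafCount ≡ size t
  objective≡size = begin
    objective leafCount                                    ≡⟨ ∑-filterᵇ (mono T) (rects nx ny) leafCount ⟩
    ∑ (rects nx ny) (λ R → ⟦ mono T R ⟧ · leafCount R)    ≡⟨ ∑-leafCount (λ R → ⟦ mono T R ⟧) ⟩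
    ∑ (leaves t) (λ L → ⟦ mono T L ⟧)                     ≡⟨ ∑-cong (leaves t) (λ L L∈ → cong ⟦_⟧ (All-lookup monoLeaves L∈)) ⟩
    ∑ (leaves t) (λ _ → 1)                                 ≡⟨ ∑-const-1 (leaves t) ⟩
    size t                                                 ∎
    where open ≡-Reasoning

module Scaling (M : CancellativeOrderedMonoid) (1# : CancellativeOrderedMonoid.Carrier M)
               {nx ny nz : ℕ} (T : Rel3 nx ny nz) where
  open CancellativeOrderedMonoid M
  open Sums M
  module ℕ-PN = Program ℕ._+_ 0 1 T
  open Program _⊕_ ε 1# T

  scaled : {B : Set} → (B → ℕ) → B → Carrier
  scaled f b = f b · 1#

  ·-if : ∀ b m n a → (if b then m ℕ.+ n else m) · a ≡ (if b then m · a ⊕ n · a else m · a)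
  ·-if true m n a = ×-homo-+ a m n
  ·-if false m n a = refl

  feasible-scaled : ∀ {x y} → ℕ-PN.Feasible x y → Feasible (scaled x) (scaled y)
  feasible-scaled {x} {y} (covered , conserved) = covered′ , conserved′
    where
    into out : Rect nx ny → List (Branch nx ny)
    into R = filterᵇ (λ g → inPartᵇ R (proj₂ g)) (Γ nx ny)
    out R = filterᵇ (λ g → eqRᵇ (proj₁ g) R) (Γ nx ny)
    covered′ : ∀ i j → sumOver (filterᵇ (cellIn i j) (monoRects T)) (scaled x) ≡ 1#
    covered′ i j = trans (sym (∑ℕ-· (filterᵇ (cellIn i j) (monoRects T)) x 1#)) (trans (cong (_· 1#) (covered i j)) (×-homo-1 1#))
    conserved′ : ∀ R → R ∈ rects nx ny → R ≢ fullR →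
      sumOver (into R) (scaled y) ≡ (if mono T R then sumOver (out R) (scaled y) ⊕ scaled x R else sumOver (out R) (scaled y))
    conserved′ R R∈ R≢full =
      trans (sym (∑ℕ-· (into R) y 1#))
        (trans (cong (_· 1#) (conserved R R∈ R≢full))
          (trans (·-if (mono T R) (∑ℕ (out R) y) (x R) 1#)
                 (cong (λ s → if mono T R then s ⊕ scaled x R else s) (∑ℕ-· (out R) y 1#))))

  objective-scaled : ∀ x → objective (scaled x) ≡ ℕ-PN.objective x · 1#
  objective-scaled x = sym (∑ℕ-· (monoRects T) x 1#)

-- Lower bound for fractional solutions

module LowerBound (M : CancellativeOrderedMonoid) (1# : CancellativeOrderedMonoid.Carrier M)
                  {nx ny nz : ℕ} (T : Rel3 nx ny nz) (total : Total T) (i₀ : Fin nx) (j₀ : Fin ny)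
                  (x : Rect nx ny → CancellativeOrderedMonoid.Carrier M)
                  (y : Branch nx ny → CancellativeOrderedMonoid.Carrier M) where
  open CancellativeOrderedMonoid M
  open Sums M
  open Picking M
  open Counting using (proper; ∑-proper-inPart; ∑-eqRᵇ)
  open Program _⊕_ ε 1# T
  open OptimalTrees T using (minLeaves; minLeaves-mono; minLeaves-subadditive)

  weighted : (Branch nx ny → ℕ) → Carrier
  weighted w = ∑ (Γ nx ny) (λ g → w g · y g)

  inflow outflow : Rect nx ny → Carrier
  inflow R = sumOver (filterᵇ (λ g → inPartᵇ R (proj₂ g)) (Γ nx ny)) y
  outflow R = sumOver (filterᵇ (λ g → eqRᵇ (proj₁ g) R) (Γ nx ny)) y

  weighted-cong : ∀ {v w} → (∀ g → IsBranch g → v g ≡ w g) → weighted v ≡ weighted w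
  weighted-cong v≡w = ∑-cong (Γ nx ny) (λ g g∈ → cong (_· y g) (v≡w g (Γ-isBranch g∈)))

  ∑-weighted : ∀ (c : Rect nx ny → ℕ) (k : Rect nx ny → Branch nx ny → ℕ) →
               ∑ (rects nx ny) (λ R → c R · weighted (k R)) ≡ weighted (λ g → ∑ℕ (rects nx ny) (λ R → c R ℕ.* k R g))
  ∑-weighted c k = begin
    ∑ (rects nx ny) (λ R → c R · ∑ (Γ nx ny) (λ g → k R g · y g))
      ≡⟨ ∑-cong′ (rects nx ny) (λ R → ·-∑ (c R) (Γ nx ny) _) ⟩
    ∑ (rects nx ny) (λ R → ∑ (Γ nx ny) (λ g → c R · k R g · y g))          ≡⟨ ∑-comm (rects nx ny) (Γ nx ny) _ ⟩
    ∑ (Γ nx ny) (λ g → ∑ (rects nx ny) (λ R → c R · k R g · y g))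
      ≡⟨ ∑-cong′ (Γ nx ny) (λ g → ∑-cong′ (rects nx ny) (λ R → ×-assocˡ (y g) (c R) (k R g))) ⟩
    ∑ (Γ nx ny) (λ g → ∑ (rects nx ny) (λ R → (c R ℕ.* k R g) · y g))
      ≡⟨ ∑-cong′ (Γ nx ny) (λ g → sym (∑ℕ-· (rects nx ny) (λ R → c R ℕ.* k R g) (y g))) ⟩
    weighted (λ g → ∑ℕ (rects nx ny) (λ R → c R ℕ.* k R g))              ∎
    where open ≡-Reasoning

  ∑-inflow : ∀ (f : Rect nx ny → ℕ) → ∑ (rects nx ny) (λ R → (proper R ℕ.* f R) · inflow R)
                                       ≡ weighted (λ g → f (proj₁ (proj₂ g)) ℕ.+ f (proj₂ (proj₂ g)))
  ∑-inflow f =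
    trans (∑-cong′ (rects nx ny) (λ R → cong (proper R ℕ.* f R ·_) (∑-filterᵇ (λ g → inPartᵇ R (proj₂ g)) (Γ nx ny) y)))
      (trans (∑-weighted (λ R → proper R ℕ.* f R) (λ R g → ⟦ inPartᵇ R (proj₂ g) ⟧))
        (weighted-cong λ { (V , (A , B)) (neV , AB∈) → ∑-proper-inPart f neV AB∈ }))

  ∑-outflow : ∀ (f : Rect nx ny → ℕ) → ∑ (rects nx ny) (λ R → f R · outflow R) ≡ weighted (λ g → f (proj₁ g))
  ∑-outflow f =
    trans (∑-cong′ (rects nx ny) (λ R → cong (f R ·_) (∑-filterᵇ (λ g → eqRᵇ (proj₁ g) R) (Γ nx ny) y)))
      (trans (∑-weighted f (λ R g → ⟦ eqRᵇ (proj₁ g) R ⟧))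
        (weighted-cong λ { (V , _) (neV , _) → ∑-eqRᵇ V f neV }))

  ∑-rects-full : ∀ (h : Rect nx ny → Carrier) → ∑ (rects nx ny) h ≡ h fullR ⊕ ∑ (rects nx ny) (λ R → proper R · h R)
  ∑-rects-full h = begin
    ∑ (rects nx ny) h                                                              ≡⟨ ∑-cong′ (rects nx ny) split ⟩
    ∑ (rects nx ny) (λ R → ⟦ eqRᵇ R fullR ⟧ · h R ⊕ proper R · h R)             ≡⟨ ∑-⊕ (rects nx ny) _ _ ⟩
    ∑ (rects nx ny) (λ R → ⟦ eqRᵇ R fullR ⟧ · h R) ⊕ ∑ (rects nx ny) (λ R → proper R · h R)
      ≡⟨ cong (_⊕ ∑ (rects nx ny) (λ R → proper R · h R))
              (trans (∑-rects-pick fullR h) (trans (cong (λ b → ⟦ b ⟧ · h fullR) (nonemptyR-full i₀ j₀)) (×-homo-1 _))) ⟩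
    h fullR ⊕ ∑ (rects nx ny) (λ R → proper R · h R)                              ∎
    where
    open ≡-Reasoning
    split : ∀ R → h R ≡ ⟦ eqRᵇ R fullR ⟧ · h R ⊕ proper R · h R
    split R with eqRᵇ R fullR
    ... | true = sym (trans (⊕-identityʳ _) (⊕-identityʳ _))
    ... | false = sym (trans (⊕-identityˡ _) (⊕-identityʳ _))

  monoMass : (Rect nx ny → ℕ) → Carrier
  monoMass f = ∑ (rects nx ny) (λ R → (proper R ℕ.* f R ℕ.* ⟦ mono T R ⟧) · x R)

  module _ (feasible : Feasible x y) (y≥0 : ∀ g → ε ≼ y g) where

    flow-weighted : ∀ R → R ∈ rects nx ny → (c : ℕ) →
      (proper R ℕ.* c) · inflow R ≡ (proper R ℕ.* c) · outflow R ⊕ (proper R ℕ.* c ℕ.* ⟦ mono T R ⟧) · x R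
    flow-weighted R R∈ c with eqRᵇ R fullR in isFull
    ... | true = sym (⊕-identityˡ ε)
    ... | false with proj₂ feasible R R∈ (eqRᵇ≡false⇒≢ R fullR isFull)
    ...   | conserved with mono T R
    ...     | true = trans (cong ((1 ℕ.* c) ·_) conserved)
                       (trans (×-distrib-+ _ _ (1 ℕ.* c))
                              (cong (λ m → (1 ℕ.* c) · outflow R ⊕ m · x R) (sym (ℕP.*-identityʳ (1 ℕ.* c)))))
    ...     | false = trans (cong ((1 ℕ.* c) ·_) conserved)
                        (sym (trans (cong (λ m → (1 ℕ.* c) · outflow R ⊕ m · x R) (ℕP.*-zeroʳ (1 ℕ.* c))) (⊕-identityʳ _)))

    properOutflow : (Rect nx ny → ℕ) → Carrier
    properOutflow f = ∑ (rects nx ny) (λ R → (proper R ℕ.* f R) · outflow R)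

    flow-identity : ∀ f → properOutflow f ⊕ monoMass f ≡ weighted (λ g → f (proj₁ (proj₂ g)) ℕ.+ f (proj₂ (proj₂ g)))
    flow-identity f = trans (sym (∑-⊕ (rects nx ny) _ _))
                            (trans (sym (∑-cong (rects nx ny) (λ R R∈ → flow-weighted R R∈ (f R)))) (∑-inflow f))

    dual-identity : ∀ f → weighted (λ g → f (proj₁ g)) ≡ f fullR · outflow fullR ⊕ properOutflow f
    dual-identity f = trans (sym (∑-outflow f)) (trans (∑-rects-full (λ R → f R · outflow R))
                        (cong (f fullR · outflow fullR ⊕_) (∑-cong′ (rects nx ny) (λ R → ×-assocˡ (outflow R) (proper R) (f R)))))

    weighted-mono : ∀ {v w} → (∀ g → IsBranch g → v g ≤ w g) → weighted v ≼ weighted w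
    weighted-mono v≤w = ∑-mono (Γ nx ny) (λ g g∈ → ·-monoˡ (y g) (y≥0 g) (v≤w g (Γ-isBranch g∈)))

    subadditive-bound : ∀ f → (∀ {V A B} → nonemptyRᵇ V ≡ true → (A , B) ∈ parts V → f V ≤ f A ℕ.+ f B) →
                        f fullR · outflow fullR ≼ monoMass f
    subadditive-bound f sub = ⊕-cancelˡ-≼ (properOutflow f) (begin
      properOutflow f ⊕ f fullR · outflow fullR   ≡⟨ ⊕-comm _ _ ⟩
      f fullR · outflow fullR ⊕ properOutflow f   ≡⟨ sym (dual-identity f) ⟩
      weighted (λ g → f (proj₁ g))                 ≲⟨ weighted-mono (λ { (V , (A , B)) (neV , AB∈) → sub neV AB∈ }) ⟩
      weighted (λ g → f (proj₁ (proj₂ g)) ℕ.+ f (proj₂ (proj₂ g)))  ≡⟨ sym (flow-identity f) ⟩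
      properOutflow f ⊕ monoMass f                 ∎)
      where open ≼-Reasoning

    superadditive-bound : ∀ f → (∀ {V A B} → nonemptyRᵇ V ≡ true → (A , B) ∈ parts V → f A ℕ.+ f B ≤ f V) →
                          monoMass f ≼ f fullR · outflow fullR
    superadditive-bound f super = ⊕-cancelˡ-≼ (properOutflow f) (begin
      properOutflow f ⊕ monoMass f                 ≡⟨ flow-identity f ⟩
      weighted (λ g → f (proj₁ (proj₂ g)) ℕ.+ f (proj₂ (proj₂ g)))  ≲⟨ weighted-mono (λ { (V , (A , B)) (neV , AB∈) → super neV AB∈ }) ⟩
      weighted (λ g → f (proj₁ g))                 ≡⟨ dual-identity f ⟩
      f fullR · outflow fullR ⊕ properOutflow f   ≡⟨ ⊕-comm _ _ ⟩
      properOutflow f ⊕ f fullR · outflow fullR   ∎)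
      where open ≼-Reasoning

    cellAt : Rect nx ny → ℕ
    cellAt R = ⟦ cellIn i₀ j₀ R ⟧

    monoMass-cellAt≤outflow : monoMass cellAt ≼ outflow fullR
    monoMass-cellAt≤outflow =
      ≼-trans (superadditive-bound cellAt (λ {V} {A} {B} _ AB∈ → ℕP.≤-reflexive (sym (⟦cellIn⟧-split (parts⇒Splits V A B AB∈) i₀ j₀))))
              (≼-reflexive (trans (cong (λ b → ⟦ b ⟧ · outflow fullR) (cellIn-full i₀ j₀)) (×-homo-1 _)))

    minLeaves·outflow≤monoMass : minLeaves fullR · outflow fullR ≼ monoMass (λ _ → 1)
    minLeaves·outflow≤monoMass =
      ≼-trans (subadditive-bound minLeaves (minLeaves-subadditive total))
              (≼-reflexive (∑-cong′ (rects nx ny) (λ R → only-mono-counts R (mono T R) refl)))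
      where
      only-mono-counts : ∀ R b → mono T R ≡ b → (proper R ℕ.* minLeaves R ℕ.* ⟦ b ⟧) · x R ≡ (proper R ℕ.* 1 ℕ.* ⟦ b ⟧) · x R
      only-mono-counts R true monoR rewrite minLeaves-mono R monoR = refl
      only-mono-counts R false _ rewrite ℕP.*-zeroʳ (proper R ℕ.* minLeaves R) | ℕP.*-zeroʳ (proper R ℕ.* 1) = refl

    covering-identity : 1# ≡ ⟦ mono T fullR ⟧ · x fullR ⊕ monoMass cellAt
    covering-identity = begin
      1#                                                              ≡⟨ sym (proj₁ feasible i₀ j₀) ⟩
      sumOver (filterᵇ (cellIn i₀ j₀) (filterᵇ (mono T) (rects nx ny))) x
        ≡⟨ ∑-filterᵇ (cellIn i₀ j₀) (filterᵇ (mono T) (rects nx ny)) x ⟩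
      ∑ (filterᵇ (mono T) (rects nx ny)) (λ R → cellAt R · x R)      ≡⟨ ∑-filterᵇ (mono T) (rects nx ny) _ ⟩
      ∑ (rects nx ny) (λ R → ⟦ mono T R ⟧ · cellAt R · x R)          ≡⟨ ∑-rects-full _ ⟩
      ⟦ mono T fullR ⟧ · cellAt fullR · x fullR ⊕ ∑ (rects nx ny) (λ R → proper R · ⟦ mono T R ⟧ · cellAt R · x R)
        ≡⟨ cong₂ _⊕_ (cong (λ b → ⟦ mono T fullR ⟧ · b) (trans (cong (λ b → ⟦ b ⟧ · x fullR) (cellIn-full i₀ j₀)) (×-homo-1 _)))
                     (∑-cong′ (rects nx ny) regroup) ⟩
      ⟦ mono T fullR ⟧ · x fullR ⊕ monoMass cellAt                    ∎
      where
      open ≡-Reasoning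
      regroup : ∀ R → proper R · ⟦ mono T R ⟧ · cellAt R · x R ≡ (proper R ℕ.* cellAt R ℕ.* ⟦ mono T R ⟧) · x R
      regroup R = trans (cong (proper R ·_) (·-swap ⟦ mono T R ⟧ (cellAt R) (x R)))
                        (trans (×-assocˡ (⟦ mono T R ⟧ · x R) (proper R) (cellAt R))
                               (×-assocˡ (x R) (proper R ℕ.* cellAt R) ⟦ mono T R ⟧))

    objective-identity : objective x ≡ ⟦ mono T fullR ⟧ · x fullR ⊕ monoMass (λ _ → 1)
    objective-identity = trans (∑-filterᵇ (mono T) (rects nx ny) x) (trans (∑-rects-full _)
                           (cong (⟦ mono T fullR ⟧ · x fullR ⊕_) (∑-cong′ (rects nx ny) regroup)))
      where
      regroup : ∀ R → proper R · ⟦ mono T R ⟧ · x R ≡ (proper R ℕ.* 1 ℕ.* ⟦ mono T R ⟧) · x R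
      regroup R = sym (trans (cong (λ m → (m ℕ.* ⟦ mono T R ⟧) · x R) (ℕP.*-identityʳ (proper R)))
                             (sym (×-assocˡ (x R) (proper R) ⟦ mono T R ⟧)))

    lower-bound : minLeaves fullR · 1# ≼ objective x
    lower-bound = by-cases (mono T fullR) refl
      where
      open ≼-Reasoning
      m = minLeaves fullR
      by-cases : ∀ b → mono T fullR ≡ b → m · 1# ≼ objective x
      by-cases true monoFull = begin
        m · 1#                                        ≡⟨ cong (_· 1#) (minLeaves-mono fullR monoFull) ⟩
        1 · 1#                                        ≡⟨ ×-homo-1 1# ⟩
        1#                                            ≡⟨ covering-identity ⟩
        ⟦ mono T fullR ⟧ · x fullR ⊕ monoMass cellAt ≲⟨ ⊕-mono-≼ ≼-refl monoMass-cellAt≤outflow ⟩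
        ⟦ mono T fullR ⟧ · x fullR ⊕ outflow fullR   ≡⟨ cong (⟦ mono T fullR ⟧ · x fullR ⊕_) (sym (×-homo-1 _)) ⟩
        ⟦ mono T fullR ⟧ · x fullR ⊕ 1 · outflow fullR
          ≡⟨ cong (λ k → ⟦ mono T fullR ⟧ · x fullR ⊕ k · outflow fullR) (sym (minLeaves-mono fullR monoFull)) ⟩
        ⟦ mono T fullR ⟧ · x fullR ⊕ m · outflow fullR ≲⟨ ⊕-mono-≼ ≼-refl minLeaves·outflow≤monoMass ⟩
        ⟦ mono T fullR ⟧ · x fullR ⊕ monoMass (λ _ → 1) ≡⟨ sym objective-identity ⟩
        objective x                                   ∎
      by-cases false monoFull = begin
        m · 1#                                        ≡⟨ cong (m ·_) covering-identity ⟩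
        m · (⟦ mono T fullR ⟧ · x fullR ⊕ monoMass cellAt)
          ≡⟨ cong (λ b → m · (⟦ b ⟧ · x fullR ⊕ monoMass cellAt)) monoFull ⟩
        m · (ε ⊕ monoMass cellAt)                     ≡⟨ cong (m ·_) (⊕-identityˡ _) ⟩
        m · monoMass cellAt                           ≲⟨ ·-monoʳ m monoMass-cellAt≤outflow ⟩
        m · outflow fullR                             ≲⟨ minLeaves·outflow≤monoMass ⟩
        monoMass (λ _ → 1)                            ≡⟨ sym (⊕-identityˡ _) ⟩
        ε ⊕ monoMass (λ _ → 1)                        ≡⟨ cong (λ b → ⟦ b ⟧ · x fullR ⊕ monoMass (λ _ → 1)) (sym monoFull) ⟩
        ⟦ mono T fullR ⟧ · x fullR ⊕ monoMass (λ _ → 1) ≡⟨ sym objective-identity ⟩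
        objective x                                   ∎

module ℚSums = Sums ℚ-monoid

n·1≡n/1 : ∀ n → n ℚSums.· 1ℚ ≡ (+ n) ℚ./ 1
n·1≡n/1 zero = refl
n·1≡n/1 (suc n) = trans (cong (1ℚ ℚ.+_) (trans (n·1≡n/1 n) n/1≡mkℚ))
                        (cong (λ z → z ℚ./ 1) (cong (λ z → + 1 ℤ.+ z) (ℤP.*-identityʳ (+ n))))
  where
  n/1≡mkℚ : (+ n) ℚ./ 1 ≡ mkℚ (+ n) 0 (Coprime.sym (Coprime.1-coprimeTo n))
  n/1≡mkℚ = ℚP.normalize-coprime (Coprime.sym (Coprime.1-coprimeTo n))

n·1ℚ≥0 : ∀ n → 0ℚ ℚ.≤ n ℚSums.· 1ℚ
n·1ℚ≥0 n = ℚSums.·-monoˡ {0} {n} 1ℚ (ℚ.*≤* (ℤ.+≤+ z≤n)) z≤n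

-- Optimality of C^P(T) for PN(T) and for its relaxation

module Optimality {nx ny nz : ℕ} (T : Rel3 nx ny nz) (total : Total T) (i₀ : Fin nx) (j₀ : Fin ny) where
  open OptimalTrees T
  open Counting using (·≡*; leaves-disjoint; leaves-cover)

  optimal : Tree (fullR {nx} {ny})
  optimal = minTree fullR

  optimal-monoLeaves : MonoLeaves T optimal
  optimal-monoLeaves = minTree-monoLeaves total fullR (nonemptyR-full i₀ j₀)

  protocolPartitionNumber : ProtocolPartitionNumber T (minLeaves fullR)
  protocolPartitionNumber = (leaves optimal , recPartitions , refl) , minimal
    where
    recPartitions : RecPartitions T (leaves optimal)
    recPartitions = All-map (λ {L} neL → ∈-rects L neL) (leaves-nonempty optimal (nonemptyR-full i₀ j₀))
                  , optimal-monoLeaves , leaves-disjoint optimal , leaves-cover optimal , optimal , ↭-refl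
    minimal : ∀ ℛ → RecPartitions T ℛ → minLeaves fullR ≤ length ℛ
    minimal ℛ (_ , monos , _ , _ , t , leaves↭ℛ) =
      ℕP.≤-trans (minLeaves-≤ t (All-resp-↭ (↭-sym leaves↭ℛ) monos)) (ℕP.≤-reflexive (↭-length leaves↭ℛ))

  open TreeSolution T optimal optimal-monoLeaves (nonemptyR-full i₀ j₀) using (leafCount; branchCount; feasible; objective≡size)

  ipOptimalValue : IPOptimalValue T (minLeaves fullR)
  ipOptimalValue = (leafCount , branchCount , feasible , objective≡size) , minimal
    where
    minimal : ∀ x y → Program.Feasible ℕ._+_ 0 1 T x y → minLeaves fullR ≤ Program.objective ℕ._+_ 0 1 T x
    minimal x y feasible-xy =
      ℕP.≤-trans (ℕP.≤-reflexive (sym (trans (·≡* (minLeaves fullR) 1) (ℕP.*-identityʳ _))))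
                 (LowerBound.lower-bound ℕ-monoid 1 T total i₀ j₀ x y feasible-xy (λ _ → z≤n))

  open Scaling ℚ-monoid 1ℚ T using (scaled; feasible-scaled; objective-scaled)

  lpOptimalValue : LPOptimalValue T (minLeaves fullR)
  lpOptimalValue =
    ( scaled leafCount , scaled branchCount
    , (λ R → n·1ℚ≥0 (leafCount R)) , (λ g → n·1ℚ≥0 (branchCount g))
    , feasible-scaled feasible
    , trans (objective-scaled leafCount) (trans (cong (ℚSums._· 1ℚ) objective≡size) (n·1≡n/1 (minLeaves fullR))))
    , minimal
    where
    minimal : ∀ x y → NonNeg x → NonNeg y → Program.Feasible ℚ._+_ 0ℚ 1ℚ T x y →
              (+ minLeaves fullR) ℚ./ 1 ℚ.≤ Program.objective ℚ._+_ 0ℚ 1ℚ T x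
    -- The bound needs y ≥ 0 but not x ≥ 0.
    minimal x y _ y≥0 feasible-xy =
      subst (ℚ._≤ Program.objective ℚ._+_ 0ℚ 1ℚ T x) (n·1≡n/1 (minLeaves fullR))
            (LowerBound.lower-bound ℚ-monoid 1ℚ T total i₀ j₀ x y feasible-xy y≥0)

corollary2 : (nx ny nz : ℕ) (T : Rel3 nx ny nz) →
    (∃ λ (x : Fin nx) → ∃ λ (y : Fin ny) → ∃ λ (z : Fin nz) → T x y z ≡ true) →
    (∀ (x : Fin nx) (y : Fin ny) → ∃ λ (z : Fin nz) → T x y z ≡ true) →
    Σ ℕ λ k → ProtocolPartitionNumber T k × IPOptimalValue T k × LPOptimalValue T k
corollary2 nx ny nz T (i₀ , j₀ , _) total =
  minLeaves fullR , protocolPartitionNumber , ipOptimalValue , lpOptimalValue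
  where
  open OptimalTrees T using (minLeaves)
  open Optimality T total i₀ j₀
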